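{- Let $N$ be a coloopless simple binary matroid with at least $4$ elements that is not $3$-connected. If $e$ is an element of $N$ such that $si(N/e)$ is $3$-connected, then $e$ belongs to a series class of $N$ with at least two elements.
   Context: $si(\cdot)$ denotes the simplification of a matroid. A series class of $N$ is an equivalence class of the relation "$x=y$ or $\{x,y\}$ is a cocircuit of $N$" on non-coloop elements. -}

module Defs where

open import Data.Nat using (ℕ; zero; suc; _+_; _≤_; _<_)
open import Data.Bool using (Bool; true; false; _∧_; _xor_)
open import Data.Fin using (Fin)
import Data.Fin as F
open import Data.Vec using (lookup)
open import Data.Fin.Subset using (Subset; _∈_; _∉_; _⊆_; _∪_; _─_; ∣_∣; ⁅_⁆; Nonempty; ⊤)
open import Data.Product using (Σ; ∃; _×_; _,_)
open import Data.Sum using (_⊎_)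
open import Relation.Nullary using (¬_)
open import Relation.Binary.PropositionalEquality using (_≡_; _≢_)

-- Binary matroids: the column matroid of an m × n matrix over GF(2).
-- Elements are the columns (Fin n); entries are Bool (false = 0,
-- true = 1, addition = xor).

Matrix₂ : ℕ → ℕ → Set
Matrix₂ m n = Fin m → Fin n → Bool

xorSum : ∀ {n} → (Fin n → Bool) → Bool
xorSum {zero}  f = false
xorSum {suc n} f = f F.zero xor xorSum (λ j → f (F.suc j))

colSum : ∀ {m n} → Matrix₂ m n → Subset n → Fin m → Bool
colSum A J i = xorSum (λ j → lookup J j ∧ A i j)

Indep₂ : ∀ {m n} → Matrix₂ m n → Subset n → Set
Indep₂ A I = ∀ J → J ⊆ I → Nonempty J → ¬ (∀ i → colSum A J i ≡ false)

Rank₂ : ∀ {m n} → Matrix₂ m n → Subset n → ℕ → Set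
Rank₂ A X k =
  (Σ (Subset _) λ I → I ⊆ X × Indep₂ A I × ∣ I ∣ ≡ k) ×
  (∀ I → I ⊆ X → Indep₂ A I → ∣ I ∣ ≤ k)

-- Generic matroid notions for a matroid given by its rank function
-- (as a relation  Rk X k  meaning r(X) = k) on a ground set G ⊆ Fin n.

RankRel : ℕ → Set₁
RankRel n = Subset n → ℕ → Set

module _ {n : ℕ} (Rk : RankRel n) (G : Subset n) where

  IsLoop : Fin n → Set
  IsLoop x = x ∈ G × Rk ⁅ x ⁆ 0

  Parallel : Fin n → Fin n → Set
  Parallel x y = x ∈ G × y ∈ G × x ≢ y × ¬ IsLoop x × ¬ IsLoop y
                 × Rk (⁅ x ⁆ ∪ ⁅ y ⁆) 1

  Simple : Set
  Simple = (∀ x → ¬ IsLoop x) × (∀ x y → ¬ Parallel x y)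

  IsColoop : Fin n → Set
  IsColoop x = x ∈ G × Σ ℕ λ a → Σ ℕ λ b → Rk (G ─ ⁅ x ⁆) a × Rk G b × a < b

  Coloopless : Set
  Coloopless = ∀ x → ¬ IsColoop x

  -- C ⊆ G is a cocircuit: a minimal nonempty set whose complement in G
  -- is non-spanning, i.e. r(G - C) < r(G) and r(G - C') = r(G) for C' ⊊ C.
  NonSpanningCompl : Subset n → Set
  NonSpanningCompl C = Σ ℕ λ a → Σ ℕ λ b → Rk (G ─ C) a × Rk G b × a < b

  IsCocircuit : Subset n → Set
  IsCocircuit C = C ⊆ G × Nonempty C × NonSpanningCompl C
                  × (∀ C' → C' ⊆ C → Nonempty C' → NonSpanningCompl C' → C ⊆ C')

  SeriesRel : Fin n → Fin n → Set
  SeriesRel x y = x ∈ G × y ∈ G × ¬ IsColoop x × ¬ IsColoop y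
                  × (x ≡ y ⊎ IsCocircuit (⁅ x ⁆ ∪ ⁅ y ⁆))

  InNontrivialSeriesClass : Fin n → Set
  InNontrivialSeriesClass x = Σ (Fin n) λ y → y ≢ x × SeriesRel x y

  Separation : ℕ → Subset n → Set
  Separation k X = X ⊆ G × k ≤ ∣ X ∣ × k ≤ ∣ G ─ X ∣ ×
    (Σ ℕ λ a → Σ ℕ λ b → Σ ℕ λ c →
       Rk X a × Rk (G ─ X) b × Rk G c × a + b < c + k)

  ThreeConnected : Set
  ThreeConnected = ∀ k → 1 ≤ k → k < 3 → ∀ X → ¬ Separation k X

  IsSimplificationSet : Subset n → Set
  IsSimplificationSet S =
    S ⊆ G ×
    (∀ x → x ∈ S → ¬ IsLoop x) ×
    (∀ x y → x ∈ S → y ∈ S → ¬ Parallel x y) ×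
    (∀ x → x ∈ G → ¬ IsLoop x → Σ (Fin n) λ y → y ∈ S × (x ≡ y ⊎ Parallel x y))

-- rank relation of the contraction M/e:  r_{M/e}(X) = r(X ∪ {e}) - r({e})
-- (its ground set is G - e)
ContractRk : ∀ {n} → RankRel n → Fin n → RankRel n
ContractRk Rk e X k = Σ ℕ λ a → Σ ℕ λ b → Rk (X ∪ ⁅ e ⁆) a × Rk ⁅ e ⁆ b × k + b ≡ a

-- si(M) is 3-connected (M given by Rk on ground set G):
-- some simplification of M (a restriction of M) is 3-connected.
-- (All simplifications are isomorphic, so the choice is immaterial.)
SiThreeConnected : ∀ {n} → RankRel n → Subset n → Set
SiThreeConnected Rk G = Σ (Subset _) λ S → IsSimplificationSet Rk G S × ThreeConnected Rk S

module Submission where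

-- Write r = r(N) and E for the ground set.  Because N has no
-- coloops, {e, y} is a cocircuit as soon as r(E - {e, y}) < r: its proper
-- nonempty subsets are singletons, whose complements are spanning.  So it
-- suffices to find y ≠ e with r(E - {e, y}) < r.  Suppose there is none;
-- we show that N is 3-connected, a contradiction.  Let S be the ground
-- set of the 3-connected simplification of N/e.  In a binary matroid
-- every x ∉ S ∪ e is parallel in N/e to some s ∈ S, i.e. x = s + e as
-- vectors.  Given a k-separation (X, Y) of N with e ∈ X and k ≤ 2, put
-- P = S ∩ X and Q = S - X; a case analysis on r(X) + r(Y) and on whether
-- e ∈ cl(Y) shows that (P, Q) is a 1- or 2-separation of si(N/e), unless
-- some E - {e, y} is spanned by a set of rank < r.

open import Defs
open import Data.Nat using (ℕ; zero; suc; _+_; _∸_; _≤_; _<_; z≤n; s≤s)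
open import Data.Nat.Properties
  using ( ≤-refl; ≤-trans; ≤-reflexive; ≤-antisym; ≤-pred; _≤?_; ≰⇒>; ≮⇒≥; <⇒≱
        ; ≤∧≢⇒<; n≤1+n; n≤0⇒n≡0; 1+n≰n; 1+n≢0; n≮n
        ; +-comm; +-assoc; +-suc; +-mono-≤; +-cancelˡ-≤; m∸n+n≡m )
import Data.Nat.Properties as ℕP
open import Data.Bool using (Bool; true; false; _∧_; _∨_; _xor_; not)
open import Data.Bool.Properties
  using ( ∧-comm; ∧-assoc; ∧-zeroʳ; ∧-identityʳ; ∨-zeroʳ; ∨-identityʳ
        ; xor-comm; xor-assoc; xor-identityʳ; ∧-distribˡ-xor; ∧-distribʳ-xor
        ; not-involutive )
import Data.Bool.Properties as BoolP
open import Data.Fin using (Fin)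
import Data.Fin as F
import Data.Fin.Properties as FinP
open import Data.Vec using ([]; _∷_; lookup; tabulate; zipWith)
open import Data.Vec.Properties
  using (lookup∘tabulate; tabulate∘lookup; tabulate-cong; lookup-zipWith; lookup-replicate; []=⇒lookup; lookup⇒[]=)
open import Data.Fin.Subset using (Subset; _∈_; _⊆_; _∪_; _∩_; _─_; ∣_∣; ⁅_⁆; Nonempty; ⊤; ⊥)
open import Data.Fin.Subset.Properties using (_⊆?_; anySubset?; nonempty?; ∣p∣≤n; ∣⁅x⁆∣≡1; p⊆q⇒∣p∣≤∣q∣)
open import Data.Product using (Σ; _×_; _,_; proj₁; proj₂)
open import Data.Sum using (_⊎_; inj₁; inj₂; [_,_]′)
open import Data.Empty using () renaming (⊥ to Empty; ⊥-elim to absurd)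
open import Relation.Nullary using (¬_; Dec; yes; no)
open import Relation.Nullary.Decidable using (_×-dec_; ¬?)
open import Relation.Binary.PropositionalEquality

xorSum-cong : ∀ {p} {f g : Fin p → Bool} → (∀ j → f j ≡ g j) → xorSum f ≡ xorSum g
xorSum-cong {zero} h = refl
xorSum-cong {suc p} h = cong₂ _xor_ (h F.zero) (xorSum-cong (λ j → h (F.suc j)))

xorSum-false : ∀ {p} → xorSum {p} (λ _ → false) ≡ false
xorSum-false {zero} = refl
xorSum-false {suc p} = xorSum-false {p}

xor-interchange : ∀ a b c d → (a xor b) xor (c xor d) ≡ (a xor c) xor (b xor d)
xor-interchange a b c d = begin
  (a xor b) xor (c xor d)   ≡⟨ xor-assoc a b (c xor d) ⟩
  a xor (b xor (c xor d))   ≡⟨ cong (a xor_) (sym (xor-assoc b c d)) ⟩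
  a xor ((b xor c) xor d)   ≡⟨ cong (λ t → a xor (t xor d)) (xor-comm b c) ⟩
  a xor ((c xor b) xor d)   ≡⟨ cong (a xor_) (xor-assoc c b d) ⟩
  a xor (c xor (b xor d))   ≡⟨ sym (xor-assoc a c (b xor d)) ⟩
  (a xor c) xor (b xor d)   ∎
  where open ≡-Reasoning

xorSum-xor : ∀ {p} (f g : Fin p → Bool) → xorSum (λ j → f j xor g j) ≡ xorSum f xor xorSum g
xorSum-xor {zero} f g = refl
xorSum-xor {suc p} f g =
  trans (cong ((f F.zero xor g F.zero) xor_) (xorSum-xor (λ j → f (F.suc j)) (λ j → g (F.suc j))))
        (xor-interchange (f F.zero) (g F.zero) _ _)

xorSum-∧ˡ : ∀ {p} (b : Bool) (f : Fin p → Bool) → xorSum (λ j → b ∧ f j) ≡ b ∧ xorSum f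
xorSum-∧ˡ {p} false f = xorSum-false {p}
xorSum-∧ˡ true f = refl

xorSum-∧ʳ : ∀ {p} (b : Bool) (f : Fin p → Bool) → xorSum (λ j → f j ∧ b) ≡ xorSum f ∧ b
xorSum-∧ʳ b f = trans (xorSum-cong (λ j → ∧-comm (f j) b)) (trans (xorSum-∧ˡ b f) (∧-comm b _))

xorSum-swap : ∀ {p q} (h : Fin p → Fin q → Bool) →
  xorSum (λ j → xorSum (λ t → h j t)) ≡ xorSum (λ t → xorSum (λ j → h j t))
xorSum-swap {zero} {q} h = sym (xorSum-false {q})
xorSum-swap {suc p} h =
  trans (cong (xorSum (h F.zero) xor_) (xorSum-swap (λ j → h (F.suc j))))
        (sym (xorSum-xor (h F.zero) (λ t → xorSum (λ j → h (F.suc j) t))))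

xorSum-true⇒ : ∀ {p} (f : Fin p → Bool) → xorSum f ≡ true → Σ (Fin p) λ j → f j ≡ true
xorSum-true⇒ {zero} f ()
xorSum-true⇒ {suc p} f eq with f F.zero in f0
... | true = F.zero , f0
... | false = let (j , fj) = xorSum-true⇒ (λ j → f (F.suc j)) eq in F.suc j , fj

xorSum-single : ∀ {p} (k : Fin p) (f : Fin p → Bool) → (∀ j → j ≢ k → f j ≡ false) → xorSum f ≡ f k
xorSum-single {suc p} F.zero f h =
  trans (cong (f F.zero xor_) (trans (xorSum-cong (λ j → h (F.suc j) (λ ()))) (xorSum-false {p}))) (xor-identityʳ _)
xorSum-single {suc p} (F.suc k) f h =
  trans (cong (_xor xorSum (λ j → f (F.suc j))) (h F.zero (λ ())))
        (xorSum-single k (λ j → f (F.suc j)) (λ j j≢k → h (F.suc j) (λ eq → j≢k (FinP.suc-injective eq))))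

xor≡false⇒≡ : ∀ {a b} → a xor b ≡ false → a ≡ b
xor≡false⇒≡ {false} {false} _ = refl
xor≡false⇒≡ {true} {true} _ = refl

xor-move : ∀ {a b c} → a xor b ≡ c → b ≡ a xor c
xor-move {false} refl = refl
xor-move {true} {false} refl = refl
xor-move {true} {true} refl = refl

xor-true⇒ : ∀ {a b} → a xor b ≡ true → a ≡ true ⊎ b ≡ true
xor-true⇒ {true} _ = inj₁ refl
xor-true⇒ {false} h = inj₂ h

xor-swap : ∀ {a b c} → a ≡ b xor c → b ≡ a xor c
xor-swap {a} {b} {c} a≡b+c = trans (xor-move {c} (trans (xor-comm c b) (sym a≡b+c))) (xor-comm c a)

xor-cancel-common : ∀ a b c → (a xor c) xor (b xor c) ≡ a xor b
xor-cancel-common a b c =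
  trans (xor-interchange a c b c) (trans (cong ((a xor b) xor_) (BoolP.xor-same c)) (xor-identityʳ (a xor b)))

-- Subsets of Fin n as Boolean vectors.  Membership is handled through
-- lookup p x ≡ true throughout; _⊑_ is inclusion in this form.

bool-split : ∀ (b : Bool) → b ≡ true ⊎ b ≡ false
bool-split true = inj₁ refl
bool-split false = inj₂ refl

true-and-false : ∀ {b} → b ≡ true → b ≡ false → Empty
true-and-false refl ()

_⊑_ : ∀ {n} → Subset n → Subset n → Set
J ⊑ K = ∀ x → lookup J x ≡ true → lookup K x ≡ true

∈→lk : ∀ {n} {x : Fin n} {p} → x ∈ p → lookup p x ≡ true
∈→lk = []=⇒lookup

lk→∈ : ∀ {n} {x : Fin n} {p} → lookup p x ≡ true → x ∈ p
lk→∈ {x = x} {p} = lookup⇒[]= x p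

⊆→⊑ : ∀ {n} {J K : Subset n} → J ⊆ K → J ⊑ K
⊆→⊑ s x h = ∈→lk (s (lk→∈ h))

⊑→⊆ : ∀ {n} {J K : Subset n} → J ⊑ K → J ⊆ K
⊑→⊆ h {x} x∈J = lk→∈ (h x (∈→lk x∈J))

subset-ext : ∀ {n} {p q : Subset n} → (∀ x → lookup p x ≡ lookup q x) → p ≡ q
subset-ext {p = p} {q} h = trans (sym (tabulate∘lookup p)) (trans (tabulate-cong h) (tabulate∘lookup q))

lk-∪ : ∀ {n} (p q : Subset n) x → lookup (p ∪ q) x ≡ lookup p x ∨ lookup q x
lk-∪ p q x = lookup-zipWith _∨_ x p q

lk-∩ : ∀ {n} (p q : Subset n) x → lookup (p ∩ q) x ≡ lookup p x ∧ lookup q x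
lk-∩ p q x = lookup-zipWith _∧_ x p q

lk-─ : ∀ {n} (p q : Subset n) x → lookup (p ─ q) x ≡ lookup p x ∧ not (lookup q x)
lk-─ (a ∷ p) (true ∷ q) F.zero = sym (∧-zeroʳ a)
lk-─ (a ∷ p) (false ∷ q) F.zero = sym (∧-identityʳ a)
lk-─ (a ∷ p) (b ∷ q) (F.suc x) = lk-─ p q x

lk-⊤ : ∀ {n} (x : Fin n) → lookup ⊤ x ≡ true
lk-⊤ x = lookup-replicate x true

lk-⊥ : ∀ {n} (x : Fin n) → lookup ⊥ x ≡ false
lk-⊥ x = lookup-replicate x false

lk-tabulate : ∀ {n} (f : Fin n → Bool) x → lookup (tabulate f) x ≡ f x
lk-tabulate f x = lookup∘tabulate f x

lk-⁅⁆-same : ∀ {n} (k : Fin n) → lookup ⁅ k ⁆ k ≡ true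
lk-⁅⁆-same F.zero = refl
lk-⁅⁆-same (F.suc k) = lk-⁅⁆-same k

lk-⁅⁆-diff : ∀ {n} (k x : Fin n) → x ≢ k → lookup ⁅ k ⁆ x ≡ false
lk-⁅⁆-diff F.zero F.zero x≢k = absurd (x≢k refl)
lk-⁅⁆-diff F.zero (F.suc x) _ = lk-⊥ x
lk-⁅⁆-diff (F.suc k) F.zero _ = refl
lk-⁅⁆-diff (F.suc k) (F.suc x) x≢k = lk-⁅⁆-diff k x (λ eq → x≢k (cong F.suc eq))

lk-⁅⁆-eq : ∀ {n} (k x : Fin n) → lookup ⁅ k ⁆ x ≡ true → x ≡ k
lk-⁅⁆-eq k x h with x FinP.≟ k
... | yes eq = eq
... | no x≢k = absurd (true-and-false h (lk-⁅⁆-diff k x x≢k))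

∪-elim : ∀ {n} (p q : Subset n) y → lookup (p ∪ q) y ≡ true → lookup p y ≡ true ⊎ lookup q y ≡ true
∪-elim p q y h with lookup p y | lk-∪ p q y
... | true | _ = inj₁ refl
... | false | eq = inj₂ (trans (sym eq) h)

∪-inl : ∀ {n} (p q : Subset n) y → lookup p y ≡ true → lookup (p ∪ q) y ≡ true
∪-inl p q y h = trans (lk-∪ p q y) (cong (_∨ lookup q y) h)

∪-inr : ∀ {n} (p q : Subset n) y → lookup q y ≡ true → lookup (p ∪ q) y ≡ true
∪-inr p q y h = trans (lk-∪ p q y) (trans (cong (lookup p y ∨_) h) (∨-zeroʳ (lookup p y)))

─-elim : ∀ {n} (p q : Subset n) y → lookup (p ─ q) y ≡ true → lookup p y ≡ true × lookup q y ≡ false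
─-elim p q y h with lookup p y | lookup q y | lk-─ p q y
... | true | false | _ = refl , refl
... | true | true | eq = absurd (true-and-false h eq)
... | false | _ | eq = absurd (true-and-false h eq)

─-intro : ∀ {n} (p q : Subset n) y → lookup p y ≡ true → lookup q y ≡ false → lookup (p ─ q) y ≡ true
─-intro p q y h1 h2 = trans (lk-─ p q y) (cong₂ (λ a b → a ∧ not b) h1 h2)

∩-elim : ∀ {n} (p q : Subset n) y → lookup (p ∩ q) y ≡ true → lookup p y ≡ true × lookup q y ≡ true
∩-elim p q y h with lookup p y | lookup q y | lk-∩ p q y
... | true | true | _ = refl , refl
... | true | false | eq = absurd (true-and-false h eq)
... | false | _ | eq = absurd (true-and-false h eq)

∩-intro : ∀ {n} (p q : Subset n) y → lookup p y ≡ true → lookup q y ≡ true → lookup (p ∩ q) y ≡ true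
∩-intro p q y h1 h2 = trans (lk-∩ p q y) (cong₂ _∧_ h1 h2)

lk-remove : ∀ {n} (J : Subset n) (x t : Fin n) → t ≢ x → lookup (J ─ ⁅ x ⁆) t ≡ lookup J t
lk-remove J x t t≢x =
  trans (lk-─ J ⁅ x ⁆ t) (trans (cong (λ b → lookup J t ∧ not b) (lk-⁅⁆-diff x t t≢x)) (∧-identityʳ (lookup J t)))

lk-remove-self : ∀ {n} (J : Subset n) (x : Fin n) → lookup (J ─ ⁅ x ⁆) x ≡ false
lk-remove-self J x = trans (lk-─ J ⁅ x ⁆ x) (trans (cong (λ b → lookup J x ∧ not b) (lk-⁅⁆-same x)) (∧-zeroʳ (lookup J x)))

single-⊑ : ∀ {n} (X : Subset n) x → lookup X x ≡ true → ⁅ x ⁆ ⊑ X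
single-⊑ X x x∈X t t∈x = subst (λ u → lookup X u ≡ true) (sym (lk-⁅⁆-eq x t t∈x)) x∈X

pair : ∀ {n} → Fin n → Fin n → Subset n
pair x y = ⁅ x ⁆ ∪ ⁅ y ⁆

triple : ∀ {n} → Fin n → Fin n → Fin n → Subset n
triple x y z = pair x y ∪ ⁅ z ⁆

pair-fst : ∀ {n} (x y : Fin n) → lookup (pair x y) x ≡ true
pair-fst x y = ∪-inl ⁅ x ⁆ ⁅ y ⁆ x (lk-⁅⁆-same x)

pair-snd : ∀ {n} (x y : Fin n) → lookup (pair x y) y ≡ true
pair-snd x y = ∪-inr ⁅ x ⁆ ⁅ y ⁆ y (lk-⁅⁆-same y)

pair-elim : ∀ {n} (x y t : Fin n) → lookup (pair x y) t ≡ true → t ≡ x ⊎ t ≡ y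
pair-elim x y t h = [ (λ a → inj₁ (lk-⁅⁆-eq x t a)) , (λ b → inj₂ (lk-⁅⁆-eq y t b)) ]′ (∪-elim ⁅ x ⁆ ⁅ y ⁆ t h)

triple-elim : ∀ {n} (x y z t : Fin n) → lookup (triple x y z) t ≡ true → t ≡ x ⊎ t ≡ y ⊎ t ≡ z
triple-elim x y z t h with ∪-elim (pair x y) ⁅ z ⁆ t h
... | inj₁ a = [ inj₁ , (λ t≡y → inj₂ (inj₁ t≡y)) ]′ (pair-elim x y t a)
... | inj₂ b = inj₂ (inj₂ (lk-⁅⁆-eq z t b))

pair-⊑ : ∀ {n} (X : Subset n) x y → lookup X x ≡ true → lookup X y ≡ true → pair x y ⊑ X
pair-⊑ X x y hx hy t h = [ (λ { refl → hx }) , (λ { refl → hy }) ]′ (pair-elim x y t h)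

triple-⊑ : ∀ {n} (X : Subset n) x y z → lookup X x ≡ true → lookup X y ≡ true → lookup X z ≡ true →
  triple x y z ⊑ X
triple-⊑ X x y z hx hy hz t h =
  [ (λ { refl → hx }) , [ (λ { refl → hy }) , (λ { refl → hz }) ]′ ]′ (triple-elim x y z t h)

b2n : Bool → ℕ
b2n true = 1
b2n false = 0

count : ∀ {n} → (Fin n → Bool) → ℕ
count {zero} f = 0
count {suc n} f = b2n (f F.zero) + count (λ j → f (F.suc j))

card≡count : ∀ {n} (p : Subset n) → ∣ p ∣ ≡ count (lookup p)
card≡count [] = refl
card≡count (true ∷ p) = cong suc (card≡count p)
card≡count (false ∷ p) = card≡count p

count-cong : ∀ {n} {f g : Fin n → Bool} → (∀ j → f j ≡ g j) → count f ≡ count g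
count-cong {zero} h = refl
count-cong {suc n} h = cong₂ _+_ (cong b2n (h F.zero)) (count-cong (λ j → h (F.suc j)))

count-∨ : ∀ {n} (f g : Fin n → Bool) → count (λ j → f j ∨ g j) ≤ count f + count g
count-∨ {zero} f g = z≤n
count-∨ {suc n} f g with f F.zero | g F.zero | count-∨ (λ j → f (F.suc j)) (λ j → g (F.suc j))
... | true | true | ih = s≤s (≤-trans ih (≤-trans (n≤1+n _) (≤-reflexive (sym (+-suc _ _)))))
... | true | false | ih = s≤s ih
... | false | true | ih = ≤-trans (s≤s ih) (≤-reflexive (sym (+-suc _ _)))
... | false | false | ih = ih

count-pos : ∀ {n} (f : Fin n → Bool) → 1 ≤ count f → Σ (Fin n) λ j → f j ≡ true
count-pos {zero} f ()
count-pos {suc n} f le with f F.zero in f0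
... | true = F.zero , f0
... | false = let (j , fj) = count-pos (λ j → f (F.suc j)) le in F.suc j , fj

count-zero : ∀ {n} (f : Fin n → Bool) → (∀ j → f j ≡ false) → count f ≡ 0
count-zero {zero} f h = refl
count-zero {suc n} f h rewrite h F.zero = count-zero (λ j → f (F.suc j)) (λ j → h (F.suc j))

count-remove : ∀ {n} (f g : Fin n → Bool) (k : Fin n) → f k ≡ true → g k ≡ false →
  (∀ j → j ≢ k → g j ≡ f j) → count f ≡ suc (count g)
count-remove {suc n} f g F.zero fk gk h rewrite fk | gk =
  cong suc (count-cong {f = λ j → f (F.suc j)} {g = λ j → g (F.suc j)} (λ j → sym (h (F.suc j) (λ ()))))
count-remove {suc n} f g (F.suc k) fk gk h rewrite h F.zero (λ ()) =
  trans (cong (b2n (f F.zero) +_)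
          (count-remove (λ j → f (F.suc j)) (λ j → g (F.suc j)) k fk gk
            (λ j j≢k → h (F.suc j) (λ eq → j≢k (FinP.suc-injective eq)))))
        (+-suc (b2n (f F.zero)) _)

card-remove : ∀ {n} (K : Subset n) k → lookup K k ≡ true → ∣ K ∣ ≡ suc ∣ K ─ ⁅ k ⁆ ∣
card-remove K k k∈K =
  trans (card≡count K)
        (trans (count-remove (lookup K) (lookup (K ─ ⁅ k ⁆)) k k∈K (lk-remove-self K k) (lk-remove K k))
               (cong suc (sym (card≡count (K ─ ⁅ k ⁆)))))

card-add : ∀ {n} (B : Subset n) x → lookup B x ≡ false → ∣ B ∪ ⁅ x ⁆ ∣ ≡ suc ∣ B ∣
card-add B x x∉B =
  trans (card≡count (B ∪ ⁅ x ⁆))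
        (trans (count-remove _ (lookup B) x (∪-inr B ⁅ x ⁆ x (lk-⁅⁆-same x)) x∉B unchanged)
               (cong suc (sym (card≡count B))))
  where
  unchanged : ∀ j → j ≢ x → lookup B j ≡ lookup (B ∪ ⁅ x ⁆) j
  unchanged j j≢x = sym (trans (lk-∪ B ⁅ x ⁆ j) (trans (cong (lookup B j ∨_) (lk-⁅⁆-diff x j j≢x)) (∨-identityʳ _)))

card-empty : ∀ {n} (K : Subset n) → (∀ y → lookup K y ≡ false) → ∣ K ∣ ≡ 0
card-empty K h = trans (card≡count K) (count-zero _ h)

card-pos : ∀ {n} (K : Subset n) → 1 ≤ ∣ K ∣ → Σ (Fin n) λ k → lookup K k ≡ true
card-pos K le = count-pos (lookup K) (≤-trans le (≤-reflexive (card≡count K)))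

card-∪ : ∀ {n} (p q : Subset n) → ∣ p ∪ q ∣ ≤ ∣ p ∣ + ∣ q ∣
card-∪ p q = ≤-trans (≤-reflexive (trans (card≡count (p ∪ q)) (count-cong (lk-∪ p q))))
  (≤-trans (count-∨ (lookup p) (lookup q)) (≤-reflexive (sym (cong₂ _+_ (card≡count p) (card≡count q)))))

card-pair : ∀ {n} (x y : Fin n) → x ≢ y → ∣ pair x y ∣ ≡ 2
card-pair x y x≢y = trans (card-add ⁅ x ⁆ y (lk-⁅⁆-diff x y (λ eq → x≢y (sym eq)))) (cong suc (∣⁅x⁆∣≡1 x))

card-triple : ∀ {n} (x y z : Fin n) → x ≢ y → x ≢ z → y ≢ z → ∣ triple x y z ∣ ≡ 3
card-triple x y z x≢y x≢z y≢z = trans (card-add (pair x y) z z∉xy) (cong suc (card-pair x y x≢y))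
  where
  z∉xy : lookup (pair x y) z ≡ false
  z∉xy with bool-split (lookup (pair x y) z)
  ... | inj₂ h = h
  ... | inj₁ h = absurd ([ (λ eq → x≢z (sym eq)) , (λ eq → y≢z (sym eq)) ]′ (pair-elim x y z h))

card-mono : ∀ {n} (p q : Subset n) → p ⊑ q → ∣ p ∣ ≤ ∣ q ∣
card-mono p q s = p⊆q⇒∣p∣≤∣q∣ (⊑→⊆ {J = p} {q} s)

card≥1 : ∀ {n} (Z : Subset n) z → lookup Z z ≡ true → 1 ≤ ∣ Z ∣
card≥1 Z z z∈Z = ≤-trans (≤-reflexive (sym (∣⁅x⁆∣≡1 z)))
  (card-mono ⁅ z ⁆ Z (single-⊑ Z z z∈Z))

two-members : ∀ {n} (Z : Subset n) → 2 ≤ ∣ Z ∣ →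
  Σ (Fin n) λ x → Σ (Fin n) λ y → x ≢ y × lookup Z x ≡ true × lookup Z y ≡ true
two-members Z le =
  let (x , x∈Z) = card-pos Z (≤-trans (s≤s z≤n) le)
      (y , y∈Z-x) = card-pos (Z ─ ⁅ x ⁆) (≤-pred (≤-trans le (≤-reflexive (card-remove Z x x∈Z))))
      (y∈Z , y∉x) = ─-elim Z ⁅ x ⁆ y y∈Z-x
  in x , y , (λ x≡y → true-and-false (subst (λ u → lookup ⁅ x ⁆ u ≡ true) x≡y (lk-⁅⁆-same x)) y∉x) , x∈Z , y∈Z

at-most-one : ∀ {n} (Z : Subset n) → ∣ Z ∣ ≤ 1 → ∀ x y → lookup Z x ≡ true → lookup Z y ≡ true → x ≡ y
at-most-one Z le x y x∈Z y∈Z with x FinP.≟ y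
... | yes eq = eq
... | no x≢y = absurd (1+n≰n (≤-trans (≤-reflexive (sym (card-pair x y x≢y)))
                                     (≤-trans (card-mono (pair x y) Z (pair-⊑ Z x y x∈Z y∈Z)) le)))

Vector : ℕ → Set
Vector m = Fin m → Bool

_≈_ : ∀ {m} → Vector m → Vector m → Set
u ≈ v = ∀ i → u i ≡ v i

_≈?_ : ∀ {m} (u v : Vector m) → Dec (u ≈ v)
u ≈? v = FinP.all? (λ i → u i BoolP.≟ v i)

col : ∀ {m n} → Matrix₂ m n → Fin n → Vector m
col A j i = A i j

IsZero : ∀ {m} → Vector m → Set
IsZero v = ∀ i → v i ≡ false

InSpan : ∀ {m n} → Matrix₂ m n → Subset n → Vector m → Set
InSpan {n = n} A K v = Σ (Subset n) λ J → J ⊆ K × colSum A J ≈ v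

inSpan? : ∀ {m n} (A : Matrix₂ m n) K v → Dec (InSpan A K v)
inSpan? A K v = anySubset? (λ J → (J ⊆? K) ×-dec (colSum A J ≈? v))

Dependent : ∀ {m n} → Matrix₂ m n → Subset n → Set
Dependent {n = n} A I = Σ (Subset n) λ J → J ⊆ I × Nonempty J × IsZero (colSum A J)

dependent? : ∀ {m n} (A : Matrix₂ m n) I → Dec (Dependent A I)
dependent? A I = anySubset? (λ J → (J ⊆? I) ×-dec (nonempty? J ×-dec (colSum A J ≈? (λ _ → false))))

independent? : ∀ {m n} (A : Matrix₂ m n) I → Dec (Indep₂ A I)
independent? A I with dependent? A I
... | yes (J , s , ne , z) = no (λ ind → ind J s ne z)
... | no nd = yes (λ J s ne z → nd (J , s , ne , z))

indep-⊥ : ∀ {m n} (A : Matrix₂ m n) → Indep₂ A ⊥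
indep-⊥ A J s (y , y∈J) z = true-and-false (⊆→⊑ s y (∈→lk y∈J)) (lk-⊥ y)

_⊕_ : ∀ {n} → Subset n → Subset n → Subset n
p ⊕ q = zipWith _xor_ p q

lk-⊕ : ∀ {n} (p q : Subset n) x → lookup (p ⊕ q) x ≡ lookup p x xor lookup q x
lk-⊕ p q x = lookup-zipWith _xor_ x p q

colSum-cong : ∀ {m n} (A : Matrix₂ m n) {J K : Subset n} → (∀ j → lookup J j ≡ lookup K j) → colSum A J ≈ colSum A K
colSum-cong A h i = xorSum-cong (λ j → cong (_∧ A i j) (h j))

colSum-tabulate : ∀ {m n} (A : Matrix₂ m n) (f : Fin n → Bool) i → colSum A (tabulate f) i ≡ xorSum (λ j → f j ∧ A i j)
colSum-tabulate A f i = xorSum-cong (λ j → cong (_∧ A i j) (lk-tabulate f j))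

colSum-empty : ∀ {m n} (A : Matrix₂ m n) (J : Subset n) → (∀ t → lookup J t ≡ false) → IsZero (colSum A J)
colSum-empty {n = n} A J h i = trans (xorSum-cong (λ j → cong (_∧ A i j) (h j))) (xorSum-false {n})

colSum-single : ∀ {m n} (A : Matrix₂ m n) k → colSum A ⁅ k ⁆ ≈ col A k
colSum-single A k i =
  trans (xorSum-single k _ (λ j j≢k → cong (_∧ A i j) (lk-⁅⁆-diff k j j≢k))) (cong (_∧ A i k) (lk-⁅⁆-same k))

colSum-⊕ : ∀ {m n} (A : Matrix₂ m n) J K i → colSum A (J ⊕ K) i ≡ colSum A J i xor colSum A K i
colSum-⊕ A J K i =
  trans (xorSum-cong (λ j → trans (cong (_∧ A i j) (lk-⊕ J K j)) (∧-distribʳ-xor (A i j) (lookup J j) (lookup K j))))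
        (xorSum-xor (λ j → lookup J j ∧ A i j) (λ j → lookup K j ∧ A i j))

colSum-lincomb : ∀ {m n} (A : Matrix₂ m n) (P Q : Subset n) (c : Bool) i →
  colSum A (tabulate (λ j → lookup P j xor (c ∧ lookup Q j))) i ≡ colSum A P i xor (c ∧ colSum A Q i)
colSum-lincomb A P Q c i =
  trans (colSum-tabulate A _ i)
  (trans (xorSum-cong (λ j → trans (∧-distribʳ-xor (A i j) (lookup P j) (c ∧ lookup Q j))
                                   (cong ((lookup P j ∧ A i j) xor_) (∧-assoc c (lookup Q j) (A i j)))))
  (trans (xorSum-xor (λ j → lookup P j ∧ A i j) (λ j → c ∧ (lookup Q j ∧ A i j)))
         (cong (colSum A P i xor_) (xorSum-∧ˡ c (λ j → lookup Q j ∧ A i j)))))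

colSum-split : ∀ {m n} (A : Matrix₂ m n) J x i → colSum A J i ≡ (lookup J x ∧ A i x) xor colSum A (J ─ ⁅ x ⁆) i
colSum-split A J x i with bool-split (lookup J x)
... | inj₁ x∈J rewrite x∈J =
  trans (colSum-cong A {J} {⁅ x ⁆ ⊕ (J ─ ⁅ x ⁆)} same i)
        (trans (colSum-⊕ A ⁅ x ⁆ (J ─ ⁅ x ⁆) i) (cong (_xor colSum A (J ─ ⁅ x ⁆) i) (colSum-single A x i)))
  where
  same : ∀ j → lookup J j ≡ lookup (⁅ x ⁆ ⊕ (J ─ ⁅ x ⁆)) j
  same j with j FinP.≟ x
  ... | yes refl rewrite lk-⊕ ⁅ j ⁆ (J ─ ⁅ j ⁆) j | lk-⁅⁆-same j | lk-remove-self J j = x∈J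
  ... | no j≢x rewrite lk-⊕ ⁅ x ⁆ (J ─ ⁅ x ⁆) j | lk-⁅⁆-diff x j j≢x | lk-remove J x j j≢x = refl
... | inj₂ x∉J rewrite x∉J = colSum-cong A {J} {J ─ ⁅ x ⁆} same i
  where
  same : ∀ j → lookup J j ≡ lookup (J ─ ⁅ x ⁆) j
  same j with j FinP.≟ x
  ... | yes refl = trans x∉J (sym (lk-remove-self J j))
  ... | no j≢x = sym (lk-remove J x j j≢x)

colSum-split-∈ : ∀ {m n} (A : Matrix₂ m n) J x → lookup J x ≡ true → ∀ i →
  colSum A J i ≡ A i x xor colSum A (J ─ ⁅ x ⁆) i
colSum-split-∈ A J x x∈J i = trans (colSum-split A J x i) (cong (λ b → (b ∧ A i x) xor colSum A (J ─ ⁅ x ⁆) i) x∈J)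

colSum-split-∉ : ∀ {m n} (A : Matrix₂ m n) J x → lookup J x ≡ false → ∀ i →
  colSum A J i ≡ colSum A (J ─ ⁅ x ⁆) i
colSum-split-∉ A J x x∉J i = trans (colSum-split A J x i) (cong (λ b → (b ∧ A i x) xor colSum A (J ─ ⁅ x ⁆) i) x∉J)

remove-⊑ : ∀ {n} (J K : Subset n) x → J ⊆ K ∪ ⁅ x ⁆ → (J ─ ⁅ x ⁆) ⊑ K
remove-⊑ J K x s y h with ─-elim J ⁅ x ⁆ y h
... | (y∈J , y∉x) = [ (λ y∈K → y∈K) , (λ y∈x → absurd (true-and-false y∈x y∉x)) ]′ (∪-elim K ⁅ x ⁆ y (⊆→⊑ s y y∈J))

span-split : ∀ {m n} (A : Matrix₂ m n) K e v → InSpan A (K ∪ ⁅ e ⁆) v →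
  InSpan A K v ⊎ InSpan A K (λ i → v i xor A i e)
span-split A K e v (J , s , z) with bool-split (lookup J e)
... | inj₁ e∈J = inj₂ (J ─ ⁅ e ⁆ , ⊑→⊆ (remove-⊑ J K e s) ,
        λ i → trans (xor-move {A i e} (trans (sym (colSum-split-∈ A J e e∈J i)) (z i))) (xor-comm (A i e) (v i)))
... | inj₂ e∉J = inj₁ (J ─ ⁅ e ⁆ , ⊑→⊆ (remove-⊑ J K e s) ,
        λ i → trans (sym (colSum-split-∉ A J e e∉J i)) (z i))

indep-extend : ∀ {m n} (A : Matrix₂ m n) I x → Indep₂ A I → ¬ InSpan A I (col A x) → Indep₂ A (I ∪ ⁅ x ⁆)
indep-extend A I x ind x∉span J s ne z with bool-split (lookup J x)
... | inj₁ x∈J = x∉span (J ─ ⁅ x ⁆ , ⊑→⊆ (remove-⊑ J I x s) ,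
        λ i → sym (xor≡false⇒≡ (trans (sym (colSum-split-∈ A J x x∈J i)) (z i))))
... | inj₂ x∉J = ind J (⊑→⊆ J⊑I) ne z
  where
  J⊑I : J ⊑ I
  J⊑I y h = [ (λ y∈I → y∈I) ,
              (λ y∈x → absurd (true-and-false h (subst (λ u → lookup J u ≡ false) (sym (lk-⁅⁆-eq x y y∈x)) x∉J))) ]′
            (∪-elim I ⁅ x ⁆ y (⊆→⊑ s y h))

-- The proof is Steinitz exchange, by induction on |K|.

module Representation {m n p} (A : Matrix₂ m n) (B : Matrix₂ m p) (I : Subset n) (K : Subset p)
  (spanned : ∀ x → lookup I x ≡ true → InSpan B K (col A x)) where

  private
    choose : ∀ {x} → lookup I x ≡ true ⊎ lookup I x ≡ false → Subset p
    choose (inj₁ x∈I) = proj₁ (spanned _ x∈I)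
    choose (inj₂ _) = ⊥

    choose-spec : ∀ {x} (d : lookup I x ≡ true ⊎ lookup I x ≡ false) → lookup I x ≡ true →
      choose d ⊑ K × colSum B (choose d) ≈ col A x
    choose-spec (inj₁ x∈I) _ = ⊆→⊑ (proj₁ (proj₂ (spanned _ x∈I))) , proj₂ (proj₂ (spanned _ x∈I))
    choose-spec (inj₂ x∉I) x∈I = absurd (true-and-false x∈I x∉I)

  rep : Fin n → Subset p
  rep x = choose (bool-split (lookup I x))

  rep-⊑ : ∀ x → lookup I x ≡ true → rep x ⊑ K
  rep-⊑ x x∈I = proj₁ (choose-spec (bool-split (lookup I x)) x∈I)

  rep-sum : ∀ x → lookup I x ≡ true → colSum B (rep x) ≈ col A x
  rep-sum x x∈I = proj₂ (choose-spec (bool-split (lookup I x)) x∈I)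

  -- Pivoting on k ∈ K at a column x₀ whose representation uses k: adding
  -- col x₀ to every column whose representation uses k removes k from
  -- all representations, while I - x₀ stays independent.
  module Pivot (k : Fin p) (x₀ : Fin n) (x₀∈I : lookup I x₀ ≡ true) (k∈rep : lookup (rep x₀) k ≡ true) where

    uses-k : Fin n → Bool
    uses-k x = lookup (rep x) k

    pivoted : Matrix₂ m n
    pivoted i x = A i x xor (uses-k x ∧ A i x₀)

    pivoted-spanned : ∀ x → lookup (I ─ ⁅ x₀ ⁆) x ≡ true → InSpan B (K ─ ⁅ k ⁆) (col pivoted x)
    pivoted-spanned x x∈I' = M , ⊑→⊆ M⊑K' , sum
      where
      x∈I : lookup I x ≡ true
      x∈I = proj₁ (─-elim I ⁅ x₀ ⁆ x x∈I')
      M : Subset p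
      M = tabulate (λ t → lookup (rep x) t xor (uses-k x ∧ lookup (rep x₀) t))
      sum : colSum B M ≈ col pivoted x
      sum i = trans (colSum-lincomb B (rep x) (rep x₀) (uses-k x) i)
                    (cong₂ (λ a b → a xor (uses-k x ∧ b)) (rep-sum x x∈I i) (rep-sum x₀ x₀∈I i))
      k∉M : lookup M k ≡ false
      k∉M = trans (lk-tabulate _ k) (trans (cong (λ b → uses-k x xor (uses-k x ∧ b)) k∈rep) (cancel (uses-k x)))
        where
        cancel : ∀ c → c xor (c ∧ true) ≡ false
        cancel true = refl
        cancel false = refl
      M⊑K' : M ⊑ (K ─ ⁅ k ⁆)
      M⊑K' t t∈M with t FinP.≟ k
      ... | yes refl = absurd (true-and-false t∈M k∉M)
      ... | no t≢k with xor-true⇒ (trans (sym (lk-tabulate _ t)) t∈M)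
      ...   | inj₁ a = ─-intro K ⁅ k ⁆ t (rep-⊑ x x∈I t a) (lk-⁅⁆-diff k t t≢k)
      ...   | inj₂ b = ─-intro K ⁅ k ⁆ t (rep-⊑ x₀ x₀∈I t (proj₂ (∧-true b))) (lk-⁅⁆-diff k t t≢k)
        where
        ∧-true : ∀ {a b} → a ∧ b ≡ true → a ≡ true × b ≡ true
        ∧-true {true} h = refl , h

    -- a dependency J of the pivoted columns gives the dependency J ⊕ (parity of J) x₀ of A
    pivoted-indep : Indep₂ A I → Indep₂ pivoted (I ─ ⁅ x₀ ⁆)
    pivoted-indep ind J J⊆I' (y , y∈J) z = ind J* (⊑→⊆ J*⊑I) (y , lk→∈ y∈J*) z*
      where
      parity : Bool
      parity = xorSum (λ j → lookup J j ∧ uses-k j)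
      J* : Subset n
      J* = tabulate (λ j → lookup J j xor (parity ∧ lookup ⁅ x₀ ⁆ j))
      pivoted-sum : ∀ i → colSum pivoted J i ≡ colSum A J i xor (parity ∧ A i x₀)
      pivoted-sum i =
        trans (xorSum-cong (λ j → trans (∧-distribˡ-xor (lookup J j) (A i j) (uses-k j ∧ A i x₀))
                                         (cong ((lookup J j ∧ A i j) xor_) (sym (∧-assoc (lookup J j) (uses-k j) (A i x₀))))))
        (trans (xorSum-xor (λ j → lookup J j ∧ A i j) (λ j → (lookup J j ∧ uses-k j) ∧ A i x₀))
               (cong (colSum A J i xor_) (xorSum-∧ʳ (A i x₀) (λ j → lookup J j ∧ uses-k j))))
      z* : IsZero (colSum A J*)
      z* i = trans (colSum-lincomb A J ⁅ x₀ ⁆ parity i)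
             (trans (cong (λ b → colSum A J i xor (parity ∧ b)) (colSum-single A x₀ i))
             (trans (sym (pivoted-sum i)) (z i)))
      y∈I' : lookup (I ─ ⁅ x₀ ⁆) y ≡ true
      y∈I' = ⊆→⊑ J⊆I' y (∈→lk y∈J)
      y≢x₀ : y ≢ x₀
      y≢x₀ refl = true-and-false (lk-⁅⁆-same y) (proj₂ (─-elim I ⁅ y ⁆ y y∈I'))
      y∈J* : lookup J* y ≡ true
      y∈J* = trans (lk-tabulate _ y)
               (trans (cong₂ (λ a b → a xor (parity ∧ b)) (∈→lk y∈J) (lk-⁅⁆-diff x₀ y y≢x₀))
                      (cong (true xor_) (∧-zeroʳ parity)))
      J*⊑I : J* ⊑ I
      J*⊑I j j∈J* with xor-true⇒ (trans (sym (lk-tabulate _ j)) j∈J*)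
      ... | inj₁ a = proj₁ (─-elim I ⁅ x₀ ⁆ j (⊆→⊑ J⊆I' j a))
      ... | inj₂ b with parity | lookup ⁅ x₀ ⁆ j in eq
      ...   | true | true = subst (λ u → lookup I u ≡ true) (sym (lk-⁅⁆-eq x₀ j eq)) x₀∈I

-- over an empty K every spanned column is zero, so an independent I is empty
independent-over-∅ : ∀ {m n p} (A : Matrix₂ m n) (B : Matrix₂ m p) (I : Subset n) (K : Subset p) →
  (∀ y → lookup K y ≡ false) → Indep₂ A I → (∀ x → lookup I x ≡ true → InSpan B K (col A x)) →
  ∀ x → lookup I x ≡ false
independent-over-∅ A B I K K-empty ind spanned x with bool-split (lookup I x)
... | inj₂ x∉I = x∉I
... | inj₁ x∈I with spanned x x∈I
...   | (J , J⊆K , sum) = absurd (ind ⁅ x ⁆ (⊑→⊆ (single-⊑ I x x∈I)) (x , lk→∈ (lk-⁅⁆-same x)) zero-sum)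
  where
  J-empty : ∀ t → lookup J t ≡ false
  J-empty t with bool-split (lookup J t)
  ... | inj₁ t∈J = absurd (true-and-false (⊆→⊑ J⊆K t t∈J) (K-empty t))
  ... | inj₂ t∉J = t∉J
  zero-sum : IsZero (colSum A ⁅ x ⁆)
  zero-sum i = trans (colSum-single A x i) (trans (sym (sum i)) (colSum-empty B J J-empty i))

exchange : ∀ {m n p} (c : ℕ) (A : Matrix₂ m n) (B : Matrix₂ m p) (I : Subset n) (K : Subset p) →
  ∣ K ∣ ≡ c → Indep₂ A I → (∀ x → lookup I x ≡ true → InSpan B K (col A x)) → ∣ I ∣ ≤ c
exchange zero A B I K ∣K∣≡0 ind spanned = ≤-reflexive (card-empty I (independent-over-∅ A B I K K-empty ind spanned))
  where
  K-empty : ∀ y → lookup K y ≡ false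
  K-empty y with bool-split (lookup K y)
  ... | inj₂ y∉K = y∉K
  ... | inj₁ y∈K = absurd (1+n≰n (≤-trans (card≥1 K y y∈K) (≤-reflexive ∣K∣≡0)))
exchange {p = p} (suc c) A B I K ∣K∣≡1+c ind spanned = step (card-pos K (≤-trans (s≤s z≤n) (≤-reflexive (sym ∣K∣≡1+c))))
  where
  open Representation A B I K spanned
  ∣K-k∣≡c : ∀ k → lookup K k ≡ true → ∣ K ─ ⁅ k ⁆ ∣ ≡ c
  ∣K-k∣≡c k k∈K = ℕP.suc-injective (trans (sym (card-remove K k k∈K)) ∣K∣≡1+c)
  step : (Σ (Fin p) λ k → lookup K k ≡ true) → ∣ I ∣ ≤ suc c
  step (k , k∈K) with FinP.any? (λ x → (lookup I x BoolP.≟ true) ×-dec (lookup (rep x) k BoolP.≟ true))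
  -- no representation uses k: drop it from K
  ... | no unused = ≤-trans (exchange c A B I (K ─ ⁅ k ⁆) (∣K-k∣≡c k k∈K) ind spanned-without-k) (n≤1+n c)
    where
    spanned-without-k : ∀ x → lookup I x ≡ true → InSpan B (K ─ ⁅ k ⁆) (col A x)
    spanned-without-k x x∈I = rep x , ⊑→⊆ rep⊑K-k , rep-sum x x∈I
      where
      rep⊑K-k : rep x ⊑ (K ─ ⁅ k ⁆)
      rep⊑K-k t t∈rep with t FinP.≟ k
      ... | yes refl = absurd (unused (x , x∈I , t∈rep))
      ... | no t≢k = ─-intro K ⁅ k ⁆ t (rep-⊑ x x∈I t t∈rep) (lk-⁅⁆-diff k t t≢k)
  -- the representation of x₀ uses k: pivot and remove x₀ and k
  ... | yes (x₀ , x₀∈I , k∈rep) =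
    ≤-trans (≤-reflexive (card-remove I x₀ x₀∈I))
            (s≤s (exchange c pivoted B (I ─ ⁅ x₀ ⁆) (K ─ ⁅ k ⁆) (∣K-k∣≡c k k∈K) (pivoted-indep ind) pivoted-spanned))
    where open Pivot k x₀ x₀∈I k∈rep

span-trans : ∀ {m n} (A : Matrix₂ m n) K L v → InSpan A K v →
  (∀ k → lookup K k ≡ true → InSpan A L (col A k)) → InSpan A L v
span-trans {n = n} A K L v (J , J⊆K , sumJ) spanned = M , ⊑→⊆ M⊑L , sumM
  where
  open Representation A A K L spanned
  M : Subset n
  M = tabulate (λ t → xorSum (λ j → lookup J j ∧ lookup (rep j) t))
  M⊑L : M ⊑ L
  M⊑L t t∈M with xorSum-true⇒ _ (trans (sym (lk-tabulate _ t)) t∈M)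
  ... | (j , h) with lookup J j in j∈J | lookup (rep j) t in t∈rep
  ...   | true | true = rep-⊑ j (⊆→⊑ J⊆K j j∈J) t t∈rep
  term : ∀ i j → lookup J j ∧ colSum A (rep j) i ≡ lookup J j ∧ A i j
  term i j with bool-split (lookup J j)
  ... | inj₁ j∈J rewrite j∈J = rep-sum j (⊆→⊑ J⊆K j j∈J) i
  ... | inj₂ j∉J rewrite j∉J = refl
  sumM : colSum A M ≈ v
  sumM i = begin
    colSum A M i
      ≡⟨ colSum-tabulate A _ i ⟩
    xorSum (λ t → xorSum (λ j → lookup J j ∧ lookup (rep j) t) ∧ A i t)
      ≡⟨ xorSum-cong (λ t → trans (sym (xorSum-∧ʳ (A i t) (λ j → lookup J j ∧ lookup (rep j) t)))
                                   (xorSum-cong (λ j → ∧-assoc (lookup J j) (lookup (rep j) t) (A i t)))) ⟩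
    xorSum (λ t → xorSum (λ j → lookup J j ∧ (lookup (rep j) t ∧ A i t)))
      ≡⟨ sym (xorSum-swap (λ j t → lookup J j ∧ (lookup (rep j) t ∧ A i t))) ⟩
    xorSum (λ j → xorSum (λ t → lookup J j ∧ (lookup (rep j) t ∧ A i t)))
      ≡⟨ xorSum-cong (λ j → trans (xorSum-∧ˡ (lookup J j) (λ t → lookup (rep j) t ∧ A i t)) (term i j)) ⟩
    colSum A J i
      ≡⟨ sumJ i ⟩
    v i ∎
    where open ≡-Reasoning

-- The rank function.  Rank₂ A X k is a relation; we compute the rank by
-- searching downwards from n for the largest size of an independent
-- subset of X.

module RankSearch {m n} (A : Matrix₂ m n) (X : Subset n) where

  HasIndep : ℕ → Set
  HasIndep k = Σ (Subset n) λ I → I ⊆ X × Indep₂ A I × ∣ I ∣ ≡ k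

  hasIndep? : ∀ k → Dec (HasIndep k)
  hasIndep? k = anySubset? (λ I → (I ⊆? X) ×-dec (independent? A I ×-dec (∣ I ∣ ℕP.≟ k)))

  hasIndep-0 : HasIndep 0
  hasIndep-0 = ⊥ , ⊑→⊆ (λ y h → absurd (true-and-false h (lk-⊥ y))) , indep-⊥ A , card-empty {n} ⊥ lk-⊥

  search : (c : ℕ) → (∀ k → c < k → ¬ HasIndep k) →
    Σ ℕ λ k → HasIndep k × (∀ I → I ⊆ X → Indep₂ A I → ∣ I ∣ ≤ k)
  search c none-above with hasIndep? c
  ... | yes found = c , found , bound
    where
    bound : ∀ I → I ⊆ X → Indep₂ A I → ∣ I ∣ ≤ c
    bound I I⊆X ind with ∣ I ∣ ≤? c
    ... | yes le = le
    ... | no nle = absurd (none-above ∣ I ∣ (≰⇒> nle) (I , I⊆X , ind , refl))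
  search zero none-above | no none = absurd (none hasIndep-0)
  search (suc c) none-above | no none = search c none-above'
    where
    none-above' : ∀ k → c < k → ¬ HasIndep k
    none-above' k c<k with k ℕP.≟ suc c
    ... | yes refl = none
    ... | no k≢1+c = none-above k (≤∧≢⇒< c<k (λ eq → k≢1+c (sym eq)))

  rank : Σ ℕ λ k → Rank₂ A X k
  rank with search n (λ k n<k (I , _ , _ , ∣I∣≡k) → <⇒≱ n<k (≤-trans (≤-reflexive (sym ∣I∣≡k)) (∣p∣≤n I)))
  ... | (k , found , bound) = k , found , bound

abstract
  rk : ∀ {m n} → Matrix₂ m n → Subset n → ℕ
  rk A X = proj₁ (RankSearch.rank A X)

  rk-spec : ∀ {m n} (A : Matrix₂ m n) X → Rank₂ A X (rk A X)
  rk-spec A X = proj₂ (RankSearch.rank A X)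

rank-unique : ∀ {m n} {A : Matrix₂ m n} {X a b} → Rank₂ A X a → Rank₂ A X b → a ≡ b
rank-unique ((I , I⊆X , indI , ∣I∣≡a) , boundI) ((J , J⊆X , indJ , ∣J∣≡b) , boundJ) =
  ≤-antisym (≤-trans (≤-reflexive (sym ∣I∣≡a)) (boundJ I I⊆X indI))
            (≤-trans (≤-reflexive (sym ∣J∣≡b)) (boundI J J⊆X indJ))

rk-eq : ∀ {m n} {A : Matrix₂ m n} {X a} → Rank₂ A X a → rk A X ≡ a
rk-eq {A = A} {X} r = rank-unique (rk-spec A X) r

maximum-spans : ∀ {m n} (A : Matrix₂ m n) X k (B : Subset n) → B ⊆ X → Indep₂ A B → ∣ B ∣ ≡ k →
  (∀ I → I ⊆ X → Indep₂ A I → ∣ I ∣ ≤ k) → ∀ x → lookup X x ≡ true → InSpan A B (col A x)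
maximum-spans A X k B B⊆X ind ∣B∣≡k bound x x∈X with inSpan? A B (col A x)
... | yes in-span = in-span
... | no not-in-span =
  absurd (n≮n k (≤-trans (≤-reflexive (cong suc (sym ∣B∣≡k)))
                (≤-trans (≤-reflexive (sym (card-add B x x∉B)))
                         (bound (B ∪ ⁅ x ⁆) (⊑→⊆ B+x⊑X) (indep-extend A B x ind not-in-span)))))
  where
  x∉B : lookup B x ≡ false
  x∉B with bool-split (lookup B x)
  ... | inj₂ h = h
  ... | inj₁ h = absurd (not-in-span (⁅ x ⁆ , ⊑→⊆ (single-⊑ B x h) , colSum-single A x))
  B+x⊑X : (B ∪ ⁅ x ⁆) ⊑ X
  B+x⊑X y h = [ ⊆→⊑ B⊆X y , (λ y∈x → subst (λ u → lookup X u ≡ true) (sym (lk-⁅⁆-eq x y y∈x)) x∈X) ]′ (∪-elim B ⁅ x ⁆ y h)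

module Rank {m n} (A : Matrix₂ m n) where

  Spans : Subset n → Subset n → Set
  Spans K W = ∀ w → lookup W w ≡ true → InSpan A K (col A w)

  element-in-span : ∀ K x → lookup K x ≡ true → InSpan A K (col A x)
  element-in-span K x x∈K = ⁅ x ⁆ , ⊑→⊆ (single-⊑ K x x∈K) , colSum-single A x

  spans-self : ∀ K → Spans K K
  spans-self = element-in-span

  span-mono : ∀ {K K'} v → InSpan A K v → K ⊑ K' → InSpan A K' v
  span-mono v (J , J⊆K , sum) K⊑K' = J , ⊑→⊆ (λ y h → K⊑K' y (⊆→⊑ J⊆K y h)) , sum

  span-≈ : ∀ {K} u w → InSpan A K u → u ≈ w → InSpan A K w
  span-≈ u w (J , J⊆K , sum) u≈w = J , J⊆K , λ i → trans (sum i) (u≈w i)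

  span-add : ∀ {K} u w → InSpan A K u → InSpan A K w → InSpan A K (λ i → u i xor w i)
  span-add {K} u w (J₁ , J₁⊆K , sum₁) (J₂ , J₂⊆K , sum₂) =
    (J₁ ⊕ J₂) , ⊑→⊆ ⊕⊑K , λ i → trans (colSum-⊕ A J₁ J₂ i) (cong₂ _xor_ (sum₁ i) (sum₂ i))
    where
    ⊕⊑K : (J₁ ⊕ J₂) ⊑ K
    ⊕⊑K y h = [ ⊆→⊑ J₁⊆K y , ⊆→⊑ J₂⊆K y ]′ (xor-true⇒ (trans (sym (lk-⊕ J₁ J₂ y)) h))

  span-sum : ∀ K x u v → InSpan A K (col A u) → InSpan A K (col A v) → (∀ i → A i x ≡ A i u xor A i v) →
    InSpan A K (col A x)
  span-sum K x u v u∈ v∈ x≡u+v = span-≈ _ (col A x) (span-add (col A u) (col A v) u∈ v∈) (λ i → sym (x≡u+v i))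

  spans-trans : ∀ {K L W} → Spans K W → Spans L K → Spans L W
  spans-trans {K} {L} K→W L→K w w∈W = span-trans A K L (col A w) (K→W w w∈W) L→K

  basis : ∀ X → Σ (Subset n) λ B → B ⊑ X × Indep₂ A B × ∣ B ∣ ≡ rk A X × Spans B X
  basis X with rk-spec A X
  ... | ((B , B⊆X , ind , ∣B∣≡r) , bound) = B , ⊆→⊑ B⊆X , ind , ∣B∣≡r , maximum-spans A X (rk A X) B B⊆X ind ∣B∣≡r bound

  rk-indep : ∀ {I W} → Indep₂ A I → I ⊑ W → ∣ I ∣ ≤ rk A W
  rk-indep {I} {W} ind I⊑W = proj₂ (rk-spec A W) I (⊑→⊆ I⊑W) ind

  rk-≤-card : ∀ {W K} → Spans K W → rk A W ≤ ∣ K ∣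
  rk-≤-card {W} {K} K→W with rk-spec A W
  ... | ((I , I⊆W , ind , ∣I∣≡r) , _) =
    ≤-trans (≤-reflexive (sym ∣I∣≡r)) (exchange ∣ K ∣ A A I K refl ind (λ x x∈I → K→W x (⊆→⊑ I⊆W x x∈I)))

  rk-span : ∀ {W K} → Spans K W → rk A W ≤ rk A K
  rk-span {W} {K} K→W with basis K
  ... | (B , _ , _ , ∣B∣≡r , B→K) = ≤-trans (rk-≤-card (spans-trans {K} {B} {W} K→W B→K)) (≤-reflexive ∣B∣≡r)

  rk-mono : ∀ {W K} → W ⊑ K → rk A W ≤ rk A K
  rk-mono {W} {K} W⊑K = rk-span {W} {K} (λ w h → element-in-span K w (W⊑K w h))

  rk-card : ∀ W → rk A W ≤ ∣ W ∣
  rk-card W = rk-≤-card (spans-self W)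

  rk-cong : ∀ {W K} → (∀ x → lookup W x ≡ lookup K x) → rk A W ≡ rk A K
  rk-cong h = cong (rk A) (subset-ext h)

  rk-union : ∀ {W} K L → Spans (K ∪ L) W → rk A W ≤ rk A K + rk A L
  rk-union {W} K L K∪L→W with basis K | basis L
  ... | (BK , _ , _ , ∣BK∣≡r , BK→K) | (BL , _ , _ , ∣BL∣≡r , BL→L) =
    ≤-trans (rk-≤-card {W} {BK ∪ BL} (spans-trans {K ∪ L} {BK ∪ BL} {W} K∪L→W bases→K∪L))
            (≤-trans (card-∪ BK BL) (≤-reflexive (cong₂ _+_ ∣BK∣≡r ∣BL∣≡r)))
    where
    bases→K∪L : Spans (BK ∪ BL) (K ∪ L)
    bases→K∪L w h = [ (λ w∈K → span-mono (col A w) (BK→K w w∈K) (λ y → ∪-inl BK BL y)) ,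
                      (λ w∈L → span-mono (col A w) (BL→L w w∈L) (λ y → ∪-inr BK BL y)) ]′ (∪-elim K L w h)

  full-rank-spans : ∀ Z → rk A ⊤ ≤ rk A Z → Spans Z ⊤
  full-rank-spans Z r≤rZ with basis Z
  ... | (B , B⊑Z , ind , ∣B∣≡rZ , _) = λ w h →
    span-mono (col A w) (maximum-spans A ⊤ (rk A ⊤) B (⊑→⊆ (λ y _ → lk-⊤ y)) ind ∣B∣≡r (proj₂ (rk-spec A ⊤)) w h) B⊑Z
    where
    ∣B∣≡r : ∣ B ∣ ≡ rk A ⊤
    ∣B∣≡r = ≤-antisym (≤-trans (≤-reflexive ∣B∣≡rZ) (rk-mono (λ y _ → lk-⊤ y))) (≤-trans r≤rZ (≤-reflexive (sym ∣B∣≡rZ)))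

  -- Trading j ∈ J ⊆ B for v = Σ J: (B - j) ∪ L spans B whenever L spans v,
  -- since col j = Σ (J - j) + v.
  trade-spans : ∀ B L J j v → J ⊑ B → lookup J j ≡ true → colSum A J ≈ v → InSpan A L v →
    Spans ((B ─ ⁅ j ⁆) ∪ L) B
  trade-spans B L J j v J⊑B j∈J sumJ v∈L b b∈B with b FinP.≟ j
  ... | no b≢j = element-in-span K b (∪-inl (B ─ ⁅ j ⁆) L b (─-intro B ⁅ j ⁆ b b∈B (lk-⁅⁆-diff j b b≢j)))
    where
    K : Subset n
    K = (B ─ ⁅ j ⁆) ∪ L
  ... | yes refl = span-≈ _ (col A b) (span-add (colSum A (J ─ ⁅ b ⁆)) v rest∈K v∈K) col-b≡
    where
    K : Subset n
    K = (B ─ ⁅ b ⁆) ∪ L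
    rest∈K : InSpan A K (colSum A (J ─ ⁅ b ⁆))
    rest∈K = J ─ ⁅ b ⁆ ,
             ⊑→⊆ (λ t h → let (t∈J , t∉b) = ─-elim J ⁅ b ⁆ t h in ∪-inl (B ─ ⁅ b ⁆) L t (─-intro B ⁅ b ⁆ t (J⊑B t t∈J) t∉b)) ,
             λ i → refl
    v∈K : InSpan A K v
    v∈K = span-mono v v∈L (λ t → ∪-inr (B ─ ⁅ b ⁆) L t)
    col-b≡ : (λ i → colSum A (J ─ ⁅ b ⁆) i xor v i) ≈ col A b
    col-b≡ i = sym (xor-move {colSum A (J ─ ⁅ b ⁆) i} (trans (xor-comm (colSum A (J ─ ⁅ b ⁆) i) (A i b))
                                                           (trans (sym (colSum-split-∈ A J b j∈J i)) (sumJ i))))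

  -- If X ∪ Y spans everything and r(X) + r(Y) ≤ r(E), then the spans of
  -- X and Y have only 0 in common: otherwise a basis element of X could
  -- be traded for the common vector, giving a spanning set of size
  -- r(X) + r(Y) - 1.
  spans-meet-in-0 : ∀ X Y → Spans (X ∪ Y) ⊤ → rk A X + rk A Y ≤ rk A ⊤ →
    ∀ v → InSpan A X v → InSpan A Y v → ¬ IsZero v → Empty
  spans-meet-in-0 X Y X∪Y→E le v v∈X v∈Y v≢0 with basis X | basis Y
  ... | (BX , _ , _ , ∣BX∣≡rX , BX→X) | (BY , _ , _ , ∣BY∣≡rY , BY→Y)
    with span-trans A X BX v v∈X BX→X
  ...   | (J , J⊆BX , sumJ) with FinP.any? (λ j → lookup J j BoolP.≟ true)
  ...     | no J-empty = v≢0 (λ i → trans (sym (sumJ i)) (colSum-empty A J J-false i))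
    where
    J-false : ∀ t → lookup J t ≡ false
    J-false t = [ (λ t∈J → absurd (J-empty (t , t∈J))) , (λ t∉J → t∉J) ]′ (bool-split (lookup J t))
  ...     | yes (j , j∈J) =
    1+n≰n (≤-trans (≤-trans (≤-reflexive (cong (_+ ∣ BY ∣) (sym (card-remove BX j (⊆→⊑ J⊆BX j j∈J)))))
                            (≤-trans (≤-reflexive (cong₂ _+_ ∣BX∣≡rX ∣BY∣≡rY)) le))
                   (≤-trans (rk-≤-card {⊤} {K} K→E) (card-∪ (BX ─ ⁅ j ⁆) BY)))
    where
    K : Subset n
    K = (BX ─ ⁅ j ⁆) ∪ BY
    K→BX : Spans K BX
    K→BX = trade-spans BX BY J j v (⊆→⊑ J⊆BX) j∈J sumJ (span-trans A Y BY v v∈Y BY→Y)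
    K→X∪Y : Spans K (X ∪ Y)
    K→X∪Y w h = [ (λ w∈X → span-trans A BX K (col A w) (BX→X w w∈X) K→BX) ,
                  (λ w∈Y → span-mono (col A w) (BY→Y w w∈Y) (λ t → ∪-inr (BX ─ ⁅ j ⁆) BY t)) ]′ (∪-elim X Y w h)
    K→E : Spans K ⊤
    K→E = spans-trans {X ∪ Y} {K} {⊤} X∪Y→E K→X∪Y

colSum-pair : ∀ {m n} (A : Matrix₂ m n) (J : Subset n) (x y : Fin n) → x ≢ y → J ⊑ pair x y → ∀ i →
  colSum A J i ≡ (lookup J x ∧ A i x) xor (lookup J y ∧ A i y)
colSum-pair A J x y x≢y J⊑xy i =
  trans (colSum-split A J x i) (cong ((lookup J x ∧ A i x) xor_)
    (trans (colSum-split A (J ─ ⁅ x ⁆) y i)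
      (trans (cong₂ _xor_ (cong (_∧ A i y) (lk-remove J x y (λ eq → x≢y (sym eq))))
                         (colSum-empty A ((J ─ ⁅ x ⁆) ─ ⁅ y ⁆) rest-empty i))
             (xor-identityʳ (lookup J y ∧ A i y)))))
  where
  rest-empty : ∀ t → lookup ((J ─ ⁅ x ⁆) ─ ⁅ y ⁆) t ≡ false
  rest-empty t with bool-split (lookup ((J ─ ⁅ x ⁆) ─ ⁅ y ⁆) t)
  ... | inj₂ h = h
  ... | inj₁ h with ─-elim (J ─ ⁅ x ⁆) ⁅ y ⁆ t h
  ...   | (t∈J-x , t∉y) with ─-elim J ⁅ x ⁆ t t∈J-x
  ...     | (t∈J , t∉x) with pair-elim x y t (J⊑xy t t∈J)
  ...       | inj₁ refl = absurd (true-and-false (lk-⁅⁆-same t) t∉x)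
  ...       | inj₂ refl = absurd (true-and-false (lk-⁅⁆-same t) t∉y)

colSum-triple : ∀ {m n} (A : Matrix₂ m n) (J : Subset n) (x y z : Fin n) → x ≢ y → x ≢ z → y ≢ z →
  J ⊑ triple x y z → ∀ i →
  colSum A J i ≡ ((lookup J x ∧ A i x) xor (lookup J y ∧ A i y)) xor (lookup J z ∧ A i z)
colSum-triple A J x y z x≢y x≢z y≢z J⊑xyz i =
  trans (colSum-split A J z i)
  (trans (xor-comm (lookup J z ∧ A i z) (colSum A (J ─ ⁅ z ⁆) i))
         (cong (_xor (lookup J z ∧ A i z))
               (trans (colSum-pair A (J ─ ⁅ z ⁆) x y x≢y J-z⊑xy i)
                      (cong₂ _xor_ (cong (_∧ A i x) (lk-remove J z x x≢z))
                                   (cong (_∧ A i y) (lk-remove J z y y≢z))))))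
  where
  J-z⊑xy : (J ─ ⁅ z ⁆) ⊑ pair x y
  J-z⊑xy t h with ─-elim J ⁅ z ⁆ t h
  ... | (t∈J , t∉z) with triple-elim x y z t (J⊑xyz t t∈J)
  ...   | inj₁ refl = pair-fst t y
  ...   | inj₂ (inj₁ refl) = pair-snd x t
  ...   | inj₂ (inj₂ refl) = absurd (true-and-false (lk-⁅⁆-same t) t∉z)

indep-single : ∀ {m n} (A : Matrix₂ m n) x → ¬ IsZero (col A x) → Indep₂ A ⁅ x ⁆
indep-single A x nonzero J J⊆x (t , t∈J) z =
  nonzero (λ i → trans (sym (trans (colSum-cong A {J} {⁅ x ⁆} J≡x i) (colSum-single A x i))) (z i))
  where
  J≡x : ∀ j → lookup J j ≡ lookup ⁅ x ⁆ j
  J≡x j with bool-split (lookup J j)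
  ... | inj₁ j∈J = trans j∈J (sym (⊆→⊑ J⊆x j j∈J))
  ... | inj₂ j∉J with j FinP.≟ x
  ...   | no j≢x = trans j∉J (sym (lk-⁅⁆-diff x j j≢x))
  ...   | yes refl with lk-⁅⁆-eq j t (⊆→⊑ J⊆x t (∈→lk t∈J))
  ...     | refl = absurd (true-and-false (∈→lk t∈J) j∉J)

pair-dependency : ∀ {m n} (A : Matrix₂ m n) x y → x ≢ y → ¬ Indep₂ A (pair x y) →
  Σ Bool λ a → Σ Bool λ b → (a ∨ b) ≡ true × IsZero (λ i → (a ∧ A i x) xor (b ∧ A i y))
pair-dependency A x y x≢y not-indep with dependent? A (pair x y)
... | no nd = absurd (not-indep (λ J s ne z → nd (J , s , ne , z)))
... | yes (J , J⊆xy , (t , t∈J) , z) =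
  lookup J x , lookup J y , nontrivial , λ i → trans (sym (colSum-pair A J x y x≢y (⊆→⊑ J⊆xy) i)) (z i)
  where
  nontrivial : (lookup J x ∨ lookup J y) ≡ true
  nontrivial with pair-elim x y t (⊆→⊑ J⊆xy t (∈→lk t∈J))
  ... | inj₁ refl rewrite ∈→lk t∈J = refl
  ... | inj₂ refl rewrite ∈→lk t∈J = ∨-zeroʳ _

triple-dependency : ∀ {m n} (A : Matrix₂ m n) x y z → x ≢ y → x ≢ z → y ≢ z → ¬ Indep₂ A (triple x y z) →
  Σ Bool λ a → Σ Bool λ b → Σ Bool λ c → ((a ∨ b) ∨ c) ≡ true ×
    IsZero (λ i → ((a ∧ A i x) xor (b ∧ A i y)) xor (c ∧ A i z))
triple-dependency A x y z x≢y x≢z y≢z not-indep with dependent? A (triple x y z)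
... | no nd = absurd (not-indep (λ J s ne vanish → nd (J , s , ne , vanish)))
... | yes (J , J⊆xyz , (t , t∈J) , vanish) =
  lookup J x , lookup J y , lookup J z , nontrivial ,
  λ i → trans (sym (colSum-triple A J x y z x≢y x≢z y≢z (⊆→⊑ J⊆xyz) i)) (vanish i)
  where
  nontrivial : ((lookup J x ∨ lookup J y) ∨ lookup J z) ≡ true
  nontrivial with triple-elim x y z t (⊆→⊑ J⊆xyz t (∈→lk t∈J))
  ... | inj₁ refl rewrite ∈→lk t∈J = refl
  ... | inj₂ (inj₁ refl) rewrite ∈→lk t∈J = cong (_∨ lookup J z) (∨-zeroʳ (lookup J x))
  ... | inj₂ (inj₂ refl) rewrite ∈→lk t∈J = ∨-zeroʳ _

module SimpleBinary {m n} (A : Matrix₂ m n) (simple : Simple (Rank₂ A) ⊤) where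

  open Rank A

  nonzero : ∀ x → ¬ IsZero (col A x)
  nonzero x vanish = proj₁ simple x (lk→∈ (lk-⊤ x) , subst (Rank₂ A ⁅ x ⁆) rk≡0 (rk-spec A ⁅ x ⁆))
    where
    ∅→x : Spans ⊥ ⁅ x ⁆
    ∅→x w w∈x rewrite lk-⁅⁆-eq x w w∈x =
      ⊥ , ⊑→⊆ (λ y h → absurd (true-and-false h (lk-⊥ y))) , λ i → trans (colSum-empty A ⊥ lk-⊥ i) (sym (vanish i))
    rk≡0 : rk A ⁅ x ⁆ ≡ 0
    rk≡0 = n≤0⇒n≡0 (≤-trans (rk-≤-card {⁅ x ⁆} {⊥} ∅→x) (≤-reflexive (card-empty {n} ⊥ lk-⊥)))

  rk-single : ∀ x → rk A ⁅ x ⁆ ≡ 1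
  rk-single x = ≤-antisym (≤-trans (rk-card ⁅ x ⁆) (≤-reflexive (∣⁅x⁆∣≡1 x)))
                          (≤-trans (≤-reflexive (sym (∣⁅x⁆∣≡1 x))) (rk-indep (indep-single A x (nonzero x)) (λ _ h → h)))

  distinct : ∀ x y → x ≢ y → ¬ (col A x ≈ col A y)
  distinct x y x≢y x≈y =
    proj₂ simple x y (lk→∈ (lk-⊤ x) , lk→∈ (lk-⊤ y) , x≢y , not-loop x , not-loop y ,
                      subst (Rank₂ A (pair x y)) rk≡1 (rk-spec A (pair x y)))
    where
    not-loop : ∀ z → ¬ IsLoop (Rank₂ A) ⊤ z
    not-loop z (_ , r≡0) = 1+n≢0 (trans (sym (rk-single z)) (rk-eq r≡0))
    x→xy : Spans ⁅ x ⁆ (pair x y)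
    x→xy w w∈xy with pair-elim x y w w∈xy
    ... | inj₁ refl = element-in-span ⁅ w ⁆ w (lk-⁅⁆-same w)
    ... | inj₂ refl = span-≈ (col A x) (col A w) (element-in-span ⁅ x ⁆ x (lk-⁅⁆-same x)) x≈y
    rk≡1 : rk A (pair x y) ≡ 1
    rk≡1 = ≤-antisym (≤-trans (rk-≤-card {pair x y} {⁅ x ⁆} x→xy) (≤-reflexive (∣⁅x⁆∣≡1 x)))
                     (≤-trans (≤-reflexive (sym (rk-single x))) (rk-mono (λ t h → ∪-inl ⁅ x ⁆ ⁅ y ⁆ t h)))

  indep-pair : ∀ x y → x ≢ y → Indep₂ A (pair x y)
  indep-pair x y x≢y with independent? A (pair x y)
  ... | yes ind = ind
  ... | no not-indep with pair-dependency A x y x≢y not-indep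
  ...   | (true , true , _ , vanish) = absurd (distinct x y x≢y (λ i → xor≡false⇒≡ (vanish i)))
  ...   | (true , false , _ , vanish) = absurd (nonzero x (λ i → trans (sym (xor-identityʳ (A i x))) (vanish i)))
  ...   | (false , true , _ , vanish) = absurd (nonzero y vanish)
  ...   | (false , false , () , _)

  rk≥2 : ∀ X x y → x ≢ y → lookup X x ≡ true → lookup X y ≡ true → 2 ≤ rk A X
  rk≥2 X x y x≢y x∈X y∈X =
    ≤-trans (≤-reflexive (sym (card-pair x y x≢y))) (rk-indep (indep-pair x y x≢y) (pair-⊑ X x y x∈X y∈X))

  rk≥3 : ∀ X x y z → x ≢ y → x ≢ z → y ≢ z → Indep₂ A (triple x y z) →
    lookup X x ≡ true → lookup X y ≡ true → lookup X z ≡ true → 3 ≤ rk A X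
  rk≥3 X x y z x≢y x≢z y≢z ind x∈X y∈X z∈X =
    ≤-trans (≤-reflexive (sym (card-triple x y z x≢y x≢z y≢z))) (rk-indep ind (triple-⊑ X x y z x∈X y∈X z∈X))

  -- in a dependent triple of a simple binary matroid all three coefficients are 1
  dependent-triple : ∀ x y z → x ≢ y → x ≢ z → y ≢ z → ¬ Indep₂ A (triple x y z) → ∀ i → A i x ≡ A i y xor A i z
  dependent-triple x y z x≢y x≢z y≢z not-indep i with triple-dependency A x y z x≢y x≢z y≢z not-indep
  ... | (true , true , true , _ , vanish) = xor≡false⇒≡ (trans (sym (xor-assoc (A i x) (A i y) (A i z))) (vanish i))
  ... | (true , true , false , _ , vanish) = absurd (distinct x y x≢y (λ i → xor≡false⇒≡ (trans (sym (xor-identityʳ (A i x xor A i y))) (vanish i))))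
  ... | (true , false , true , _ , vanish) = absurd (distinct x z x≢z (λ i → xor≡false⇒≡ (trans (cong (_xor A i z) (sym (xor-identityʳ (A i x)))) (vanish i))))
  ... | (false , true , true , _ , vanish) = absurd (distinct y z y≢z (λ i → xor≡false⇒≡ (vanish i)))
  ... | (true , false , false , _ , vanish) = absurd (nonzero x (λ i → trans (sym (trans (xor-identityʳ (A i x xor false)) (xor-identityʳ (A i x)))) (vanish i)))
  ... | (false , true , false , _ , vanish) = absurd (nonzero y (λ i → trans (sym (xor-identityʳ (A i y))) (vanish i)))
  ... | (false , false , true , _ , vanish) = absurd (nonzero z vanish)
  ... | (false , false , false , () , _)

-- Since N/e has
-- rank function r(Z ∪ e) - 1, a separation of N/e|S can be detected
-- through ranks in N; and since N is binary, every element of E - e is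
-- in S or is x = s + e for some s ∈ S.

all-but : ∀ {n} → Fin n → Fin n → Subset n
all-but e y = ⊤ ─ pair e y

all-but-elim : ∀ {n} (e y w : Fin n) → lookup (all-but e y) w ≡ true → w ≢ e × w ≢ y
all-but-elim e y w h with ─-elim ⊤ (pair e y) w h
... | (_ , w∉ey) = (λ { refl → true-and-false (pair-fst w y) w∉ey }) , (λ { refl → true-and-false (pair-snd e w) w∉ey })

-- the arithmetic turning r(P ∪ e) + r(Q ∪ e) ≤ r(S ∪ e) + k into a k-separation of N/e
contracted-sum : ∀ {p q s k} → 1 ≤ p → 1 ≤ q → 1 ≤ s → p + q ≤ s + k → (p ∸ 1) + (q ∸ 1) < (s ∸ 1) + k
contracted-sum {suc p} {suc q} {suc s} {k} _ _ _ le = subst (λ t → t ≤ s + k) (+-suc p q) (≤-pred le)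

module Setting {m n} (A : Matrix₂ m n) (simple : Simple (Rank₂ A) ⊤) (coloopless : Coloopless (Rank₂ A) ⊤)
  (e : Fin n) (S : Subset n)
  (S-simplifies : IsSimplificationSet (ContractRk (Rank₂ A) e) (⊤ ─ ⁅ e ⁆) S)
  (S-connected : ThreeConnected (ContractRk (Rank₂ A) e) S) where

  open Rank A public
  open SimpleBinary A simple public

  r : ℕ
  r = rk A ⊤

  N/e : RankRel n
  N/e = ContractRk (Rank₂ A) e

  E-e : Subset n
  E-e = ⊤ ─ ⁅ e ⁆

  in-E-e : ∀ x → x ≢ e → x ∈ E-e
  in-E-e x x≢e = lk→∈ (─-intro ⊤ ⁅ e ⁆ x (lk-⊤ x) (lk-⁅⁆-diff e x x≢e))

  in-E-e⇒≢ : ∀ x → x ∈ E-e → x ≢ e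
  in-E-e⇒≢ x h refl = true-and-false (lk-⁅⁆-same x) (proj₂ (─-elim ⊤ ⁅ x ⁆ x (∈→lk h)))

  in-S⇒≢ : ∀ s → lookup S s ≡ true → s ≢ e
  in-S⇒≢ s s∈S = in-E-e⇒≢ s (proj₁ S-simplifies (lk→∈ s∈S))

  non-coloop : ∀ x → r ≤ rk A (⊤ ─ ⁅ x ⁆)
  non-coloop x with r ≤? rk A (⊤ ─ ⁅ x ⁆)
  ... | yes le = le
  ... | no nle = absurd (coloopless x (lk→∈ (lk-⊤ x) , rk A (⊤ ─ ⁅ x ⁆) , r , rk-spec A _ , rk-spec A ⊤ , ≰⇒> nle))

  rk-with-e≥1 : ∀ Z → 1 ≤ rk A (Z ∪ ⁅ e ⁆)
  rk-with-e≥1 Z = ≤-trans (≤-reflexive (sym (rk-single e))) (rk-mono (λ t h → ∪-inr Z ⁅ e ⁆ t h))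

  rk-contract : ∀ Z → N/e Z (rk A (Z ∪ ⁅ e ⁆) ∸ 1)
  rk-contract Z = rk A (Z ∪ ⁅ e ⁆) , 1 , rk-spec A _ , subst (Rank₂ A ⁅ e ⁆) (rk-single e) (rk-spec A ⁅ e ⁆) ,
                  m∸n+n≡m (rk-with-e≥1 Z)

  rank-e≡1 : ∀ {b} → Rank₂ A ⁅ e ⁆ b → b ≡ 1
  rank-e≡1 Rb = trans (sym (rk-eq Rb)) (rk-single e)

  not-loop/e : ∀ x → x ≢ e → ¬ IsLoop N/e E-e x
  not-loop/e x x≢e (_ , (a , b , Ra , Rb , a≡0+b)) =
    ℕP.<-irrefl refl (≤-trans (rk≥2 (pair x e) x e x≢e (pair-fst x e) (pair-snd x e))
                              (≤-reflexive (trans (rk-eq Ra) (trans (sym a≡0+b) (rank-e≡1 Rb)))))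

  -- parallel elements of N/e differ by e: {x, y, e} is dependent in N
  parallel/e⇒sum : ∀ x y → Parallel N/e E-e x y → ∀ i → A i x ≡ A i y xor A i e
  parallel/e⇒sum x y (x∈ , y∈ , x≢y , _ , _ , (a , b , Ra , Rb , 1+b≡a)) with independent? A (triple x y e)
  ... | no dependent = dependent-triple x y e x≢y (in-E-e⇒≢ x x∈) (in-E-e⇒≢ y y∈) dependent
  ... | yes ind = absurd (ℕP.<-irrefl refl
        (≤-trans (rk≥3 (pair x y ∪ ⁅ e ⁆) x y e x≢y (in-E-e⇒≢ x x∈) (in-E-e⇒≢ y y∈) ind
                       (∪-inl (pair x y) ⁅ e ⁆ x (pair-fst x y)) (∪-inl (pair x y) ⁅ e ⁆ y (pair-snd x y))
                       (∪-inr (pair x y) ⁅ e ⁆ e (lk-⁅⁆-same e)))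
                 (≤-reflexive (trans (rk-eq Ra) (trans (sym 1+b≡a) (cong suc (rank-e≡1 Rb)))))))

  representative : ∀ x → x ≢ e →
    Σ (Fin n) λ s → lookup S s ≡ true × (x ≡ s ⊎ (∀ i → A i x ≡ A i s xor A i e))
  representative x x≢e with proj₂ (proj₂ (proj₂ S-simplifies)) x (in-E-e x x≢e) (not-loop/e x x≢e)
  ... | (s , s∈S , inj₁ x≡s) = s , ∈→lk s∈S , inj₁ x≡s
  ... | (s , s∈S , inj₂ parallel) = s , ∈→lk s∈S , inj₂ (parallel/e⇒sum x s parallel)

  S∪e-spans : Spans (S ∪ ⁅ e ⁆) ⊤
  S∪e-spans w _ with w FinP.≟ e
  ... | yes refl = element-in-span _ w (∪-inr S ⁅ w ⁆ w (lk-⁅⁆-same w))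
  ... | no w≢e with representative w w≢e
  ...   | (s , s∈S , inj₁ refl) = element-in-span _ w (∪-inl S ⁅ e ⁆ w s∈S)
  ...   | (s , s∈S , inj₂ w≡s+e) =
    span-sum _ w s e (element-in-span _ s (∪-inl S ⁅ e ⁆ s s∈S)) (element-in-span _ e (∪-inr S ⁅ e ⁆ e (lk-⁅⁆-same e))) w≡s+e

  rk-S∪e : rk A (S ∪ ⁅ e ⁆) ≡ r
  rk-S∪e = ≤-antisym (rk-mono (λ t _ → lk-⊤ t)) (rk-span {⊤} {S ∪ ⁅ e ⁆} S∪e-spans)

  no-separation : ∀ k → 1 ≤ k → k ≤ 2 → ∀ P → P ⊑ S → k ≤ ∣ P ∣ → k ≤ ∣ S ─ P ∣ →
    rk A (P ∪ ⁅ e ⁆) + rk A ((S ─ P) ∪ ⁅ e ⁆) ≤ r + k → Empty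
  no-separation k 1≤k k≤2 P P⊑S k≤∣P∣ k≤∣S-P∣ le =
    S-connected k 1≤k (s≤s k≤2) P
      (⊑→⊆ P⊑S , k≤∣P∣ , k≤∣S-P∣ , _ , _ , _ , rk-contract P , rk-contract (S ─ P) , rk-contract S ,
       contracted-sum (rk-with-e≥1 P) (rk-with-e≥1 (S ─ P)) (rk-with-e≥1 S)
                      (≤-trans le (≤-reflexive (cong (_+ k) (sym rk-S∪e)))))

sum≤r+1 : ∀ {p q x y r} → p ≤ x → q ≤ y + 1 → x + y ≤ r → p + q ≤ r + 1
sum≤r+1 {x = x} {y} h₁ h₂ h₃ =
  ≤-trans (+-mono-≤ h₁ h₂) (≤-trans (≤-reflexive (sym (+-assoc x y 1))) (+-mono-≤ h₃ ≤-refl))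

sum≤r+2 : ∀ {p q x y r} → p ≤ x → q ≤ y + 1 → x + y ≤ r + 1 → p + q ≤ r + 2
sum≤r+2 {x = x} {y} {r} h₁ h₂ h₃ =
  ≤-trans (sum≤r+1 h₁ h₂ h₃) (≤-reflexive (+-assoc r 1 1))

-- in a 2-separation r(X) + r(Y) = r + 1, so each side of rank ≥ 2 forces the other below r
other-side< : ∀ {x y r} → 2 ≤ x → x + y ≤ r + 1 → suc y ≤ r
other-side< {x} {y} {r} 2≤x le = ≤-pred (≤-trans (+-mono-≤ 2≤x (≤-refl {y})) (≤-trans le (≤-reflexive (+-comm r 1))))

exact-2-separation : ∀ {s r k} → suc r ≤ s → s < r + k → k ≤ 2 → 2 ≤ k × s ≤ r + 1
exact-2-separation {s} {r} {k} r<s s<r+k k≤2 =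
  +-cancelˡ-≤ r 2 k (≤-trans (≤-reflexive (+-comm r 2)) (≤-trans (s≤s r<s) s<r+k)) ,
  ≤-pred (≤-trans s<r+k (≤-trans (+-mono-≤ (≤-refl {r}) k≤2) (≤-reflexive (+-suc r 1))))

small-side : ∀ {x y r} → r ≤ y + 1 → x + y ≤ r + 1 → x ≤ 2
small-side {x} {y} {r} r≤y+1 le =
  +-cancelˡ-≤ y x 2 (≤-trans (≤-reflexive (+-comm y x))
                    (≤-trans le (≤-trans (+-mono-≤ r≤y+1 (≤-refl {1})) (≤-reflexive (+-assoc y 1 1)))))

large-side : ∀ {p q r} → ¬ (p + q ≤ r + 1) → p ≤ 2 → r ≤ q
large-side {p} {q} {r} nle p≤2 =
  +-cancelˡ-≤ 2 r q (≤-trans (≤-reflexive (trans (+-comm 2 r) (+-suc r 1))) (≤-trans (≰⇒> nle) (+-mono-≤ p≤2 (≤-refl {q}))))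

module SeparationArgument {m n} (A : Matrix₂ m n) (simple : Simple (Rank₂ A) ⊤) (coloopless : Coloopless (Rank₂ A) ⊤)
  (e : Fin n) (S : Subset n)
  (S-simplifies : IsSimplificationSet (ContractRk (Rank₂ A) e) (⊤ ─ ⁅ e ⁆) S)
  (S-connected : ThreeConnected (ContractRk (Rank₂ A) e) S)
  (all-but-spanning : ∀ y → y ≢ e → rk A ⊤ ≤ rk A (all-but e y))
  (X : Subset n) (e∈X : lookup X e ≡ true) where

  open Setting A simple coloopless e S S-simplifies S-connected public

  Y : Subset n
  Y = ⊤ ─ X

  rX rY : ℕ
  rX = rk A X
  rY = rk A Y

  P Q : Subset n
  P = S ∩ X
  Q = S ─ P

  ∉X⇒∈Y : ∀ y → lookup X y ≡ false → lookup Y y ≡ true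
  ∉X⇒∈Y y y∉X = ─-intro ⊤ X y (lk-⊤ y) y∉X

  ∈Y⇒∉X : ∀ y → lookup Y y ≡ true → lookup X y ≡ false
  ∈Y⇒∉X y y∈Y = proj₂ (─-elim ⊤ X y y∈Y)

  ∉X⇒≢e : ∀ x → lookup X x ≡ false → x ≢ e
  ∉X⇒≢e x x∉X refl = true-and-false e∈X x∉X

  ∈P : ∀ s → lookup S s ≡ true → lookup X s ≡ true → lookup P s ≡ true
  ∈P s s∈S s∈X = ∩-intro S X s s∈S s∈X

  P⊑S : P ⊑ S
  P⊑S s h = proj₁ (∩-elim S X s h)

  P⊑X : P ⊑ X
  P⊑X s h = proj₂ (∩-elim S X s h)

  ∈Q : ∀ s → lookup S s ≡ true → lookup X s ≡ false → lookup Q s ≡ true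
  ∈Q s s∈S s∉X = ─-intro S P s s∈S (trans (lk-∩ S X s) (cong₂ _∧_ s∈S s∉X))

  Q⊑S : Q ⊑ S
  Q⊑S s h = proj₁ (─-elim S P s h)

  Q-outside-X : ∀ s → lookup Q s ≡ true → lookup X s ≡ false
  Q-outside-X s h with ─-elim S P s h
  ... | (s∈S , s∉P) = trans (sym (trans (lk-∩ S X s) (cong (_∧ lookup X s) s∈S))) s∉P

  X∪Y-spans : Spans (X ∪ Y) ⊤
  X∪Y-spans w _ = [ (λ w∈X → element-in-span _ w (∪-inl X Y w w∈X)) ,
                    (λ w∉X → element-in-span _ w (∪-inr X Y w (∉X⇒∈Y w w∉X))) ]′ (bool-split (lookup X w))

  rk-P∪e≤rX : rk A (P ∪ ⁅ e ⁆) ≤ rX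
  rk-P∪e≤rX = rk-mono (λ t h → [ P⊑X t , (λ t∈e → subst (λ u → lookup X u ≡ true) (sym (lk-⁅⁆-eq e t t∈e)) e∈X) ]′
                                 (∪-elim P ⁅ e ⁆ t h))

  Q∪e⊑Y∪e : (Q ∪ ⁅ e ⁆) ⊑ (Y ∪ ⁅ e ⁆)
  Q∪e⊑Y∪e t h = [ (λ t∈Q → ∪-inl Y ⁅ e ⁆ t (∉X⇒∈Y t (Q-outside-X t t∈Q))) , ∪-inr Y ⁅ e ⁆ t ]′ (∪-elim Q ⁅ e ⁆ t h)

  rk-Q∪e≤rk-Y∪e : rk A (Q ∪ ⁅ e ⁆) ≤ rk A (Y ∪ ⁅ e ⁆)
  rk-Q∪e≤rk-Y∪e = rk-mono Q∪e⊑Y∪e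

  rk-Y∪e≤rY+1 : rk A (Y ∪ ⁅ e ⁆) ≤ rY + 1
  rk-Y∪e≤rY+1 = ≤-trans (rk-union {Y ∪ ⁅ e ⁆} Y ⁅ e ⁆ (spans-self _)) (≤-reflexive (cong (rY +_) (rk-single e)))

  rk-Q∪e≤rY+1 : rk A (Q ∪ ⁅ e ⁆) ≤ rY + 1
  rk-Q∪e≤rY+1 = ≤-trans rk-Q∪e≤rk-Y∪e rk-Y∪e≤rY+1

  all-but-not-spanned : ∀ t K → t ≢ e → Spans K (all-but e t) → suc (rk A K) ≤ r → Empty
  all-but-not-spanned t K t≢e K→ rK<r = 1+n≰n (≤-trans rK<r (≤-trans (all-but-spanning t t≢e) (rk-span {all-but e t} {K} K→)))

  outside-X : ∀ y → lookup X y ≡ false →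
    lookup Q y ≡ true ⊎ (Σ (Fin n) λ s → lookup Q s ≡ true × (∀ i → A i y ≡ A i s xor A i e)) ⊎ InSpan A X (col A y)
  outside-X y y∉X with representative y (∉X⇒≢e y y∉X)
  ... | (s , s∈S , inj₁ refl) = inj₁ (∈Q y s∈S y∉X)
  ... | (s , s∈S , inj₂ y≡s+e) with bool-split (lookup X s)
  ...   | inj₁ s∈X = inj₂ (inj₂ (span-sum X y s e (element-in-span X s s∈X) (element-in-span X e e∈X) y≡s+e))
  ...   | inj₂ s∉X = inj₂ (inj₁ (s , ∈Q s s∈S s∉X , y≡s+e))

  inside-X : ∀ x → lookup X x ≡ true → x ≢ e →
    lookup P x ≡ true ⊎ (Σ (Fin n) λ s → lookup P s ≡ true) ⊎
    (Σ (Fin n) λ s → lookup X s ≡ false × (∀ i → A i x ≡ A i s xor A i e))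
  inside-X x x∈X x≢e with representative x x≢e
  ... | (s , s∈S , inj₁ refl) = inj₁ (∈P x s∈S x∈X)
  ... | (s , s∈S , inj₂ x≡s+e) with bool-split (lookup X s)
  ...   | inj₁ s∈X = inj₂ (inj₁ (s , ∈P s s∈S s∈X))
  ...   | inj₂ s∉X = inj₂ (inj₂ (s , s∉X , x≡s+e))

  Q-empty⇒X-spans : (∀ q → ¬ lookup Q q ≡ true) → Spans X ⊤
  Q-empty⇒X-spans Q-empty w _ with bool-split (lookup X w)
  ... | inj₁ w∈X = element-in-span X w w∈X
  ... | inj₂ w∉X with outside-X w w∉X
  ...   | inj₁ w∈Q = absurd (Q-empty w w∈Q)
  ...   | inj₂ (inj₁ (s , s∈Q , _)) = absurd (Q-empty s s∈Q)
  ...   | inj₂ (inj₂ w∈spanX) = w∈spanX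

  P-empty⇒Y∪e-spans : (∀ p → ¬ lookup P p ≡ true) → Spans (Y ∪ ⁅ e ⁆) ⊤
  P-empty⇒Y∪e-spans P-empty w _ with bool-split (lookup X w) | w FinP.≟ e
  ... | inj₂ w∉X | _ = element-in-span _ w (∪-inl Y ⁅ e ⁆ w (∉X⇒∈Y w w∉X))
  ... | inj₁ _ | yes refl = element-in-span _ w (∪-inr Y ⁅ w ⁆ w (lk-⁅⁆-same w))
  ... | inj₁ w∈X | no w≢e with inside-X w w∈X w≢e
  ...   | inj₁ w∈P = absurd (P-empty w w∈P)
  ...   | inj₂ (inj₁ (s , s∈P)) = absurd (P-empty s s∈P)
  ...   | inj₂ (inj₂ (s , s∉X , w≡s+e)) =
    span-sum _ w s e (element-in-span _ s (∪-inl Y ⁅ e ⁆ s (∉X⇒∈Y s s∉X)))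
                     (element-in-span _ e (∪-inr Y ⁅ e ⁆ e (lk-⁅⁆-same e))) w≡s+e

  -- (X, Y) is a 1-separation of N: then (P, Q) is one of N/e|S.
  module OneSeparation (le : rX + rY ≤ r) where

    meet : ∀ v → InSpan A X v → InSpan A Y v → ¬ IsZero v → Empty
    meet = spans-meet-in-0 X Y X∪Y-spans le

    Q-nonempty : ∀ y → lookup Y y ≡ true → Σ (Fin n) λ q → lookup Q q ≡ true
    Q-nonempty y y∈Y with outside-X y (∈Y⇒∉X y y∈Y)
    ... | inj₁ y∈Q = y , y∈Q
    ... | inj₂ (inj₁ (q , q∈Q , _)) = q , q∈Q
    ... | inj₂ (inj₂ y∈spanX) = absurd (meet (col A y) y∈spanX (element-in-span Y y y∈Y) (nonzero y))

    -- X = {e} is impossible: then r(Y) = r(E - e) = r since e is no coloop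
    X-beyond-e : Σ (Fin n) λ x → lookup X x ≡ true × x ≢ e
    X-beyond-e with FinP.any? (λ x → (lookup X x BoolP.≟ true) ×-dec ¬? (x FinP.≟ e))
    ... | yes found = found
    ... | no none = absurd (1+n≰n (≤-trans (≤-trans (≤-reflexive (cong (_+ rY) (sym rX≡1))) le)
                                         (≤-trans (non-coloop e) (≤-reflexive (rk-cong E-e≡Y)))))
      where
      X≡e : ∀ t → lookup X t ≡ lookup ⁅ e ⁆ t
      X≡e t with t FinP.≟ e
      ... | yes refl = trans e∈X (sym (lk-⁅⁆-same t))
      ... | no t≢e = [ (λ t∈X → absurd (none (t , t∈X , t≢e))) , (λ t∉X → trans t∉X (sym (lk-⁅⁆-diff e t t≢e))) ]′
                      (bool-split (lookup X t))
      rX≡1 : rX ≡ 1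
      rX≡1 = trans (rk-cong X≡e) (rk-single e)
      E-e≡Y : ∀ t → lookup (⊤ ─ ⁅ e ⁆) t ≡ lookup Y t
      E-e≡Y t = trans (lk-─ ⊤ ⁅ e ⁆ t) (trans (cong (λ b → lookup ⊤ t ∧ not b) (sym (X≡e t))) (sym (lk-─ ⊤ X t)))

    P-nonempty : Σ (Fin n) λ p → lookup P p ≡ true
    P-nonempty with X-beyond-e
    ... | (x , x∈X , x≢e) with inside-X x x∈X x≢e
    ...   | inj₁ x∈P = x , x∈P
    ...   | inj₂ (inj₁ p) = p
    ...   | inj₂ (inj₂ (s , s∉X , x≡s+e)) =
      absurd (meet (col A s)
                   (span-sum X s x e (element-in-span X x x∈X) (element-in-span X e e∈X) (λ i → xor-swap (x≡s+e i)))
                   (element-in-span Y s (∉X⇒∈Y s s∉X)) (nonzero s))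

    contradiction : ∀ y → lookup Y y ≡ true → Empty
    contradiction y y∈Y =
      no-separation 1 ≤-refl (s≤s z≤n) P P⊑S (card≥1 P _ (proj₂ P-nonempty)) (card≥1 Q _ (proj₂ (Q-nonempty y y∈Y)))
                    (sum≤r+1 rk-P∪e≤rX rk-Q∪e≤rY+1 le)

  module TwoSeparation (r<rX+rY : suc r ≤ rX + rY) (le : rX + rY ≤ r + 1) (2≤∣X∣ : 2 ≤ ∣ X ∣) (2≤∣Y∣ : 2 ≤ ∣ Y ∣) where

    rX≥2 : 2 ≤ rX
    rX≥2 with two-members X 2≤∣X∣
    ... | (x₁ , x₂ , x₁≢x₂ , x₁∈X , x₂∈X) = rk≥2 X x₁ x₂ x₁≢x₂ x₁∈X x₂∈X

    rY≥2 : 2 ≤ rY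
    rY≥2 with two-members Y 2≤∣Y∣
    ... | (y₁ , y₂ , y₁≢y₂ , y₁∈Y , y₂∈Y) = rk≥2 Y y₁ y₂ y₁≢y₂ y₁∈Y y₂∈Y

    rY<r : suc rY ≤ r
    rY<r = other-side< rX≥2 le

    rX<r : suc rX ≤ r
    rX<r = other-side< rY≥2 (≤-trans (≤-reflexive (+-comm rY rX)) le)

    X-not-spanning : Spans X ⊤ → Empty
    X-not-spanning X→E = 1+n≰n (≤-trans rX<r (rk-span {⊤} {X} X→E))

    Y-not-spanning : Spans Y ⊤ → Empty
    Y-not-spanning Y→E = 1+n≰n (≤-trans rY<r (rk-span {⊤} {Y} Y→E))

    X-beyond-e : Σ (Fin n) λ x → lookup X x ≡ true × x ≢ e
    X-beyond-e with two-members X 2≤∣X∣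
    ... | (x₁ , x₂ , x₁≢x₂ , x₁∈X , x₂∈X) with x₁ FinP.≟ e
    ...   | no x₁≢e = x₁ , x₁∈X , x₁≢e
    ...   | yes refl = x₂ , x₂∈X , (λ eq → x₁≢x₂ (sym eq))

    Q-nonempty : Σ (Fin n) λ q → lookup Q q ≡ true
    Q-nonempty with FinP.any? (λ x → lookup Q x BoolP.≟ true)
    ... | yes q = q
    ... | no none = absurd (X-not-spanning (Q-empty⇒X-spans (λ q h → none (q , h))))

    -- e ∈ cl(Y): then r((S - P) ∪ e) ≤ r(Y) and (P, Q) is a 1-separation of N/e|S
    e-in-span-Y : InSpan A Y (col A e) → Empty
    e-in-span-Y e∈spanY =
      no-separation 1 ≤-refl (s≤s z≤n) P P⊑S (card≥1 P _ (proj₂ P-nonempty)) (card≥1 Q _ (proj₂ Q-nonempty))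
        (≤-trans (+-mono-≤ rk-P∪e≤rX (≤-trans rk-Q∪e≤rk-Y∪e (rk-span {Y ∪ ⁅ e ⁆} {Y} Y→Y∪e))) le)
      where
      Y→Y∪e : Spans Y (Y ∪ ⁅ e ⁆)
      Y→Y∪e w h = [ element-in-span Y w ,
                    (λ w∈e → subst (λ u → InSpan A Y (col A u)) (sym (lk-⁅⁆-eq e w w∈e)) e∈spanY) ]′ (∪-elim Y ⁅ e ⁆ w h)
      P-nonempty : Σ (Fin n) λ p → lookup P p ≡ true
      P-nonempty with FinP.any? (λ x → lookup P x BoolP.≟ true)
      ... | yes p = p
      ... | no none = absurd (Y-not-spanning
                        (spans-trans {Y ∪ ⁅ e ⁆} {Y} {⊤} (P-empty⇒Y∪e-spans (λ p h → none (p , h))) Y→Y∪e))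

    module EOutsideSpanY (e∉spanY : ¬ InSpan A Y (col A e)) where

      -- y = s + e with y, s ∉ X would put e = s + y in cl(Y)
      outside-X-spanned : ∀ y → lookup X y ≡ false → lookup Q y ≡ true ⊎ InSpan A X (col A y)
      outside-X-spanned y y∉X with outside-X y y∉X
      ... | inj₁ y∈Q = inj₁ y∈Q
      ... | inj₂ (inj₂ y∈spanX) = inj₂ y∈spanX
      ... | inj₂ (inj₁ (s , s∈Q , y≡s+e)) =
        absurd (e∉spanY (span-sum Y e s y (element-in-span Y s (∉X⇒∈Y s (Q-outside-X s s∈Q)))
                                          (element-in-span Y y (∉X⇒∈Y y y∉X))
                                          (λ i → xor-move {A i s} (sym (y≡s+e i)))))

      -- Q = {q}: X spans E - {e, q}
      Q-small : ∣ Q ∣ ≤ 1 → Empty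
      Q-small ∣Q∣≤1 with Q-nonempty
      ... | (q , q∈Q) = all-but-not-spanned q X (in-S⇒≢ q (Q⊑S q q∈Q)) X→all-but rX<r
        where
        X→all-but : Spans X (all-but e q)
        X→all-but w w∈ with bool-split (lookup X w)
        ... | inj₁ w∈X = element-in-span X w w∈X
        ... | inj₂ w∉X with outside-X-spanned w w∉X
        ...   | inj₂ w∈spanX = w∈spanX
        ...   | inj₁ w∈Q = absurd (proj₂ (all-but-elim e q w w∈) (at-most-one Q ∣Q∣≤1 w q w∈Q q∈Q))

      -- P = ∅: Y ∪ e spans E, so r(X) ≤ 2.  For x₁ ∈ X - e no further
      -- x₂ ∈ X - {e, x₁} exists: {e, x₁, x₂} would have rank 3, or be
      -- dependent with e = x₁ + x₂ = s₁ + s₂ ∈ cl(Y).  So Y spans E - {e, x₁}.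
      P-empty : (∀ p → ¬ lookup P p ≡ true) → Empty
      P-empty P-empty with X-beyond-e
      ... | (x₁ , x₁∈X , x₁≢e) = all-but-not-spanned x₁ Y x₁≢e Y→all-but rY<r
        where
        rX≤2 : rX ≤ 2
        rX≤2 = small-side (≤-trans (rk-span {⊤} {Y ∪ ⁅ e ⁆} (P-empty⇒Y∪e-spans P-empty)) rk-Y∪e≤rY+1) le
        shift : ∀ x → lookup X x ≡ true → x ≢ e →
          Σ (Fin n) λ s → lookup X s ≡ false × (∀ i → A i x ≡ A i s xor A i e)
        shift x x∈X x≢e with inside-X x x∈X x≢e
        ... | inj₁ x∈P = absurd (P-empty x x∈P)
        ... | inj₂ (inj₁ (s , s∈P)) = absurd (P-empty s s∈P)
        ... | inj₂ (inj₂ found) = found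
        no-third : ∀ x₂ → lookup (all-but e x₁) x₂ ≡ true → lookup X x₂ ≡ true → Empty
        no-third x₂ x₂∈ x₂∈X with all-but-elim e x₁ x₂ x₂∈ | independent? A (triple e x₁ x₂)
        ... | (x₂≢e , x₂≢x₁) | yes ind =
          1+n≰n (≤-trans (rk≥3 X e x₁ x₂ (λ eq → x₁≢e (sym eq)) (λ eq → x₂≢e (sym eq)) (λ eq → x₂≢x₁ (sym eq))
                                ind e∈X x₁∈X x₂∈X) rX≤2)
        ... | (x₂≢e , x₂≢x₁) | no dependent with shift x₁ x₁∈X x₁≢e | shift x₂ x₂∈X x₂≢e
        ...   | (s₁ , s₁∉X , x₁≡s₁+e) | (s₂ , s₂∉X , x₂≡s₂+e) =
          e∉spanY (span-sum Y e s₁ s₂ (element-in-span Y s₁ (∉X⇒∈Y s₁ s₁∉X)) (element-in-span Y s₂ (∉X⇒∈Y s₂ s₂∉X))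
                     (λ i → trans (dependent-triple e x₁ x₂ (λ eq → x₁≢e (sym eq)) (λ eq → x₂≢e (sym eq))
                                                   (λ eq → x₂≢x₁ (sym eq)) dependent i)
                            (trans (cong₂ _xor_ (x₁≡s₁+e i) (x₂≡s₂+e i)) (xor-cancel-common (A i s₁) (A i s₂) (A i e)))))
        Y→all-but : Spans Y (all-but e x₁)
        Y→all-but w w∈ = [ (λ w∈X → absurd (no-third w w∈ w∈X)) , (λ w∉X → element-in-span Y w (∉X⇒∈Y w w∉X)) ]′
                           (bool-split (lookup X w))

      -- P = {p} and r(X) ≤ 2: every x ∈ X - {e, p} is p + e, so neither p
      -- nor p + e lies in cl(Y).  If p + e ∈ cl(Y), Y spans E - {e, p}; if
      -- p ∈ cl(Y), Y spans E - {e, x} for any x ∈ X - {e, p}, and E - {e, p}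
      -- if there is none.
      module SingleP (p : Fin n) (p∈P : lookup P p ≡ true) (rX≤2 : rX ≤ 2) where

        p∈X : lookup X p ≡ true
        p∈X = P⊑X p p∈P

        p≢e : p ≢ e
        p≢e = in-S⇒≢ p (P⊑S p p∈P)

        others : ∀ x → lookup X x ≡ true → x ≢ e → x ≢ p → ∀ i → A i x ≡ A i p xor A i e
        others x x∈X x≢e x≢p i with independent? A (triple e p x)
        ... | yes ind = absurd (1+n≰n (≤-trans (rk≥3 X e p x (λ eq → p≢e (sym eq)) (λ eq → x≢e (sym eq))
                                                      (λ eq → x≢p (sym eq)) ind e∈X p∈X x∈X) rX≤2))
        ... | no dependent = xor-move {A i p} (sym (dependent-triple e p x (λ eq → p≢e (sym eq)) (λ eq → x≢e (sym eq))
                                                                     (λ eq → x≢p (sym eq)) dependent i))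

        Y-part : ∀ w → lookup X w ≡ false → InSpan A Y (col A w)
        Y-part w w∉X = element-in-span Y w (∉X⇒∈Y w w∉X)

        p+e-outside-span-Y : InSpan A Y (λ i → A i p xor A i e) → Empty
        p+e-outside-span-Y p+e∈spanY = all-but-not-spanned p Y p≢e Y→all-but rY<r
          where
          Y→all-but : Spans Y (all-but e p)
          Y→all-but w w∈ with bool-split (lookup X w) | all-but-elim e p w w∈
          ... | inj₁ w∈X | (w≢e , w≢p) = span-≈ _ (col A w) p+e∈spanY (λ i → sym (others w w∈X w≢e w≢p i))
          ... | inj₂ w∉X | _ = Y-part w w∉X

        p-outside-span-Y : InSpan A Y (col A p) → Empty
        p-outside-span-Y p∈spanY with FinP.any? (λ x → (lookup X x BoolP.≟ true) ×-dec (¬? (x FinP.≟ e) ×-dec ¬? (x FinP.≟ p)))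
        ... | yes (x , x∈X , x≢e , x≢p) = all-but-not-spanned x Y x≢e Y→all-but rY<r
          where
          -- w ∈ X - {e, x, p} would be p + e = x
          Y→all-but : Spans Y (all-but e x)
          Y→all-but w w∈ with bool-split (lookup X w) | all-but-elim e x w w∈
          ... | inj₂ w∉X | _ = Y-part w w∉X
          ... | inj₁ w∈X | (w≢e , w≢x) with w FinP.≟ p
          ...   | yes refl = p∈spanY
          ...   | no w≢p = absurd (distinct w x w≢x (λ i → trans (others w w∈X w≢e w≢p i) (sym (others x x∈X x≢e x≢p i))))
        ... | no none = all-but-not-spanned p Y p≢e Y→all-but rY<r
          where
          -- X = {e, p}
          Y→all-but : Spans Y (all-but e p)
          Y→all-but w w∈ with bool-split (lookup X w) | all-but-elim e p w w∈
          ... | inj₁ w∈X | (w≢e , w≢p) = absurd (none (w , w∈X , w≢e , w≢p))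
          ... | inj₂ w∉X | _ = Y-part w w∉X

      -- P = {p}: unless (P, Q) is a 1-separation, r(Q ∪ e) = r, so Q ∪ e
      -- spans E, r(X) ≤ 2, and p ∈ cl(Y ∪ e) means p or p + e is in cl(Y).
      P-single : ∣ P ∣ ≤ 1 → ∀ p → lookup P p ≡ true → Empty
      P-single ∣P∣≤1 p p∈P with (rk A (P ∪ ⁅ e ⁆) + rk A (Q ∪ ⁅ e ⁆)) ≤? (r + 1)
      ... | yes small = no-separation 1 ≤-refl (s≤s z≤n) P P⊑S (card≥1 P p p∈P) (card≥1 Q _ (proj₂ Q-nonempty)) small
      ... | no large = [ SingleP.p-outside-span-Y p p∈P rX≤2 , SingleP.p+e-outside-span-Y p p∈P rX≤2 ]′
                         (span-split A Y e (col A p) (span-mono (col A p) (Q∪e-spans p (lk-⊤ p)) Q∪e⊑Y∪e))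
        where
        rk-P∪e≤2 : rk A (P ∪ ⁅ e ⁆) ≤ 2
        rk-P∪e≤2 = ≤-trans (rk-card (P ∪ ⁅ e ⁆)) (≤-trans (card-∪ P ⁅ e ⁆) (+-mono-≤ ∣P∣≤1 (≤-reflexive (∣⁅x⁆∣≡1 e))))
        r≤rk-Q∪e : r ≤ rk A (Q ∪ ⁅ e ⁆)
        r≤rk-Q∪e = large-side large rk-P∪e≤2
        Q∪e-spans : Spans (Q ∪ ⁅ e ⁆) ⊤
        Q∪e-spans = full-rank-spans (Q ∪ ⁅ e ⁆) r≤rk-Q∪e
        rX≤2 : rX ≤ 2
        rX≤2 = small-side (≤-trans r≤rk-Q∪e rk-Q∪e≤rY+1) le

      -- if |Q| ≥ 2 and |P| ≥ 2, (P, Q) is a 2-separation of N/e|S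
      contradiction : Empty
      contradiction with ∣ Q ∣ ≤? 1
      ... | yes ∣Q∣≤1 = Q-small ∣Q∣≤1
      ... | no ∣Q∣≰1 with ∣ P ∣ ≤? 1
      ...   | no ∣P∣≰1 = no-separation 2 (s≤s z≤n) ≤-refl P P⊑S (≰⇒> ∣P∣≰1) (≰⇒> ∣Q∣≰1)
                                     (sum≤r+2 rk-P∪e≤rX rk-Q∪e≤rY+1 le)
      ...   | yes ∣P∣≤1 with FinP.any? (λ x → lookup P x BoolP.≟ true)
      ...     | yes (p , p∈P) = P-single ∣P∣≤1 p p∈P
      ...     | no none = P-empty (λ p h → none (p , h))

    contradiction : Empty
    contradiction with inSpan? A Y (col A e)
    ... | yes e∈spanY = e-in-span-Y e∈spanY
    ... | no e∉spanY = EOutsideSpanY.contradiction e∉spanY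

  no-separation-of-N : ∀ k → 1 ≤ k → k ≤ 2 → k ≤ ∣ X ∣ → k ≤ ∣ Y ∣ → rX + rY < r + k → Empty
  no-separation-of-N k 1≤k k≤2 k≤∣X∣ k≤∣Y∣ λ<k with rX + rY ≤? r
  ... | yes le = OneSeparation.contradiction le (proj₁ y∈Y) (proj₂ y∈Y)
    where
    y∈Y : Σ (Fin n) λ y → lookup Y y ≡ true
    y∈Y = card-pos Y (≤-trans 1≤k k≤∣Y∣)
  ... | no nle with exact-2-separation (≰⇒> nle) λ<k k≤2
  ...   | (2≤k , le) = TwoSeparation.contradiction (≰⇒> nle) le (≤-trans 2≤k k≤∣X∣) (≤-trans 2≤k k≤∣Y∣)

-- If r(E - {e, y}) = r for every y ≠ e, then N is 3-connected: a
-- separation can be taken with e on the first side.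

complement-involutive : ∀ {n} (X : Subset n) → ⊤ ─ (⊤ ─ X) ≡ X
complement-involutive X = subset-ext pointwise
  where
  pointwise : ∀ t → lookup (⊤ ─ (⊤ ─ X)) t ≡ lookup X t
  pointwise t =
    trans (lk-─ ⊤ (⊤ ─ X) t)
    (trans (cong (λ b → lookup ⊤ t ∧ not b) (lk-─ ⊤ X t))
    (trans (cong (λ a → a ∧ not (a ∧ not (lookup X t))) (lk-⊤ t)) (not-involutive (lookup X t))))

three-connected : ∀ {m n} (A : Matrix₂ m n) → Simple (Rank₂ A) ⊤ → Coloopless (Rank₂ A) ⊤ →
  (e : Fin n) (S : Subset n) →
  IsSimplificationSet (ContractRk (Rank₂ A) e) (⊤ ─ ⁅ e ⁆) S → ThreeConnected (ContractRk (Rank₂ A) e) S →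
  (∀ y → y ≢ e → rk A ⊤ ≤ rk A (all-but e y)) → ThreeConnected (Rank₂ A) ⊤
three-connected A simple coloopless e S S-simplifies S-connected all-but-spanning
  k 1≤k k<3 X (_ , k≤∣X∣ , k≤∣E-X∣ , a , b , c , Ra , Rb , Rc , a+b<c+k) with bool-split (lookup X e)
... | inj₁ e∈X = Argument.no-separation-of-N X e∈X k 1≤k (≤-pred k<3) k≤∣X∣ k≤∣E-X∣ λ<k
  where module Argument = SeparationArgument A simple coloopless e S S-simplifies S-connected all-but-spanning
        λ<k : rk A X + rk A (⊤ ─ X) < rk A ⊤ + k
        λ<k = subst₂ (λ s t → s < t + k) (sym (cong₂ _+_ (rk-eq Ra) (rk-eq Rb))) (sym (rk-eq Rc)) a+b<c+k
... | inj₂ e∉X =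
  Argument.no-separation-of-N (⊤ ─ X) (─-intro ⊤ X e (lk-⊤ e) e∉X) k 1≤k (≤-pred k<3) k≤∣E-X∣
    (subst (k ≤_) (cong ∣_∣ (sym (complement-involutive X))) k≤∣X∣)
    (subst (λ s → s < rk A ⊤ + k) (trans (+-comm (rk A X) (rk A (⊤ ─ X))) (cong (rk A (⊤ ─ X) +_) (sym X-twice))) λ<k)
  where module Argument = SeparationArgument A simple coloopless e S S-simplifies S-connected all-but-spanning
        λ<k : rk A X + rk A (⊤ ─ X) < rk A ⊤ + k
        λ<k = subst₂ (λ s t → s < t + k) (sym (cong₂ _+_ (rk-eq Ra) (rk-eq Rb))) (sym (rk-eq Rc)) a+b<c+k
        X-twice : rk A (⊤ ─ (⊤ ─ X)) ≡ rk A X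
        X-twice = cong (rk A) (complement-involutive X)

-- In a coloopless matroid, r(E - {e, y}) < r makes {e, y} a cocircuit:
-- a proper nonempty subset is a singleton {v}, and r(E - v) < r would
-- make v a coloop.

singleton-of-pair : ∀ {n} (C : Subset n) u v → C ⊑ pair u v → lookup C u ≡ false → Nonempty C → C ≡ ⁅ v ⁆
singleton-of-pair C u v C⊑uv u∉C (t , t∈C) = subset-ext pointwise
  where
  member-is-v : ∀ w → lookup C w ≡ true → w ≡ v
  member-is-v w w∈C = [ (λ { refl → absurd (true-and-false w∈C u∉C) }) , (λ w≡v → w≡v) ]′ (pair-elim u v w (C⊑uv w w∈C))
  pointwise : ∀ w → lookup C w ≡ lookup ⁅ v ⁆ w
  pointwise w with bool-split (lookup C w) | w FinP.≟ v
  ... | inj₁ w∈C | _ = trans w∈C (sym (subst (λ x → lookup ⁅ v ⁆ x ≡ true) (sym (member-is-v w w∈C)) (lk-⁅⁆-same v)))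
  ... | inj₂ w∉C | no w≢v = trans w∉C (sym (lk-⁅⁆-diff v w w≢v))
  ... | inj₂ w∉C | yes refl = absurd (true-and-false (subst (λ x → lookup C x ≡ true) (member-is-v t (∈→lk t∈C)) (∈→lk t∈C)) w∉C)

pair-cocircuit : ∀ {m n} (A : Matrix₂ m n) → Coloopless (Rank₂ A) ⊤ → ∀ e y →
  rk A (all-but e y) < rk A ⊤ → IsCocircuit (Rank₂ A) ⊤ (pair e y)
pair-cocircuit A coloopless e y small =
  (λ {x} _ → lk→∈ (lk-⊤ x)) , (e , lk→∈ (pair-fst e y)) ,
  (rk A (all-but e y) , rk A ⊤ , rk-spec A _ , rk-spec A ⊤ , small) , minimal
  where
  contains : ∀ u v C → C ⊑ pair u v → Nonempty C → NonSpanningCompl (Rank₂ A) ⊤ C → lookup C u ≡ true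
  contains u v C C⊑uv ne non-spanning with bool-split (lookup C u)
  ... | inj₁ u∈C = u∈C
  ... | inj₂ u∉C = absurd (coloopless v (lk→∈ (lk-⊤ v) ,
                     subst (NonSpanningCompl (Rank₂ A) ⊤) (singleton-of-pair C u v C⊑uv u∉C ne) non-spanning))
  minimal : ∀ C → C ⊆ pair e y → Nonempty C → NonSpanningCompl (Rank₂ A) ⊤ C → pair e y ⊆ C
  minimal C C⊆ey ne non-spanning =
    ⊑→⊆ (pair-⊑ C e y (contains e y C (⊆→⊑ C⊆ey) ne non-spanning)
                      (contains y e C C⊑ye ne non-spanning))
    where
    C⊑ye : C ⊑ pair y e
    C⊑ye t h = pair-⊑ (pair y e) e y (pair-snd y e) (pair-fst y e) t (⊆→⊑ C⊆ey t h)

-- Lemma 8.1.  If some y ≠ e has r(E - {e, y}) < r, then {e, y} is a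
-- cocircuit and y is in the series class of e; otherwise N would be
-- 3-connected by three-connected.

lemma8p1 : ∀ {m n} (A : Matrix₂ m n) →
    Coloopless (Rank₂ A) ⊤ → Simple (Rank₂ A) ⊤ → 4 ≤ n →
    ¬ ThreeConnected (Rank₂ A) ⊤ →
    (e : Fin n) → SiThreeConnected (ContractRk (Rank₂ A) e) (⊤ ─ ⁅ e ⁆) →
    InNontrivialSeriesClass (Rank₂ A) ⊤ e
lemma8p1 A coloopless simple _ not-3-connected e (S , S-simplifies , S-connected)
  with FinP.any? (λ y → ¬? (y FinP.≟ e) ×-dec (suc (rk A (all-but e y)) ≤? rk A ⊤))
... | yes (y , y≢e , small) =
  y , y≢e , lk→∈ (lk-⊤ e) , lk→∈ (lk-⊤ y) , coloopless e , coloopless y , inj₂ (pair-cocircuit A coloopless e y small)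
... | no none =
  absurd (not-3-connected (three-connected A simple coloopless e S S-simplifies S-connected
                             (λ y y≢e → ≮⇒≥ (λ small → none (y , y≢e , small)))))
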